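{- Let $n\ge2$. If $w\in\Omega'_n$ and $\lambda(w)=(a_1,\dots,a_n)$, then \[\ell(w)=\sum_{1\le i<j\le n}\max(a_j-a_i-1,0)=\sum_{1\le i<j\le n}\bigl(a_j-a_i+\mathbb 1(a_i=a_j)\bigr)-\binom n2,\] where $\mathbb 1(a_i=a_j)$ is $1$ if $a_i=a_j$ and $0$ otherwise.
   Context: $\tilde S_n$ is the group of bijections $w:\mathbb Z\to\mathbb Z$ with $w(i+n)=w(i)+n$ and $\sum_{i=1}^nw(i)=\sum_{i=1}^ni$, a Coxeter group with simple generators $s_0,\dots,s_{n-1}$, $s_i$ mapping $j\mapsto j+1$ if $j\equiv i$, $j\mapsto j-1$ if $j\equiv i+1\pmod n$, fixing $j$ otherwise; $\ell$ is length; $\tau_n(i)=n+1-i$. $\Omega'_n=\{w\in\tilde S_n:(\tau_nw)^2=1,\ \ell(s_iw)=\ell(ws_i)=\ell(w)+1\ \forall 1\le i\le n-1\}$. $\lambda(w)=(\lambda_1(w),\dots,\lambda_n(w))$ with $\lambda_i(w)=\lfloor(w(i)-1)/n\rfloor$. -}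

module Defs where

open import Data.Nat as ℕ using (ℕ; zero; suc; _∸_; NonZero)
open import Data.Nat.Combinatorics using (_C_)
open import Data.Integer as ℤ using (ℤ; +_; _+_; _-_; _*_; _⊔_; _/ℕ_; _%ℕ_)
open import Data.Fin using (Fin; toℕ)
open import Data.List using (List; []; _∷_; length)
open import Data.Product using (Σ; _×_)
open import Data.Bool using (if_then_else_)
open import Function using (_∘_; id)
open import Function.Definitions using (Injective; Surjective)
open import Relation.Binary.PropositionalEquality using (_≡_)
open import Relation.Nullary.Decidable using (⌊_⌋)

ΣZ : ℕ → (ℕ → ℤ) → ℤ
ΣZ zero    f = + 0
ΣZ (suc m) f = ΣZ m f + f (suc m)

pairSum : ℕ → (ℕ → ℕ → ℤ) → ℤ
pairSum n g = ΣZ n (λ j → ΣZ (j ∸ 1) (λ i → g i j))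

record IsAffPerm (n : ℕ) (w : ℤ → ℤ) : Set where
  field
    injective  : Injective _≡_ _≡_ w
    surjective : Surjective _≡_ _≡_ w
    periodic   : ∀ i → w (i + + n) ≡ w i + + n
    windowSum  : ΣZ n (λ i → w (+ i)) ≡ ΣZ n (λ i → + i)

s : (n : ℕ) .{{_ : NonZero n}} → ℕ → ℤ → ℤ
s n i j =
  if ⌊ (j %ℕ n) ℕ.≟ (i ℕ.% n) ⌋ then j + + 1
  else if ⌊ (j %ℕ n) ℕ.≟ (suc i ℕ.% n) ⌋ then j - + 1
  else j

evalWord : (n : ℕ) .{{_ : NonZero n}} → List (Fin n) → ℤ → ℤ
evalWord n []       = id
evalWord n (i ∷ ws) = s n (toℕ i) ∘ evalWord n ws

Represents : (n : ℕ) .{{_ : NonZero n}} → List (Fin n) → (ℤ → ℤ) → Set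
Represents n ws w = ∀ x → evalWord n ws x ≡ w x

IsLength : (n : ℕ) .{{_ : NonZero n}} → (ℤ → ℤ) → ℕ → Set
IsLength n w k =
  Σ (List (Fin n)) (λ ws → length ws ≡ k × Represents n ws w)
  × (∀ ws → Represents n ws w → k ℕ.≤ length ws)

τ : ℕ → ℤ → ℤ
τ n i = + (suc n) - i

λᵢ : (n : ℕ) .{{_ : NonZero n}} → (ℤ → ℤ) → ℕ → ℤ
λᵢ n w i = (w (+ i) - + 1) /ℕ n

𝟙≡ : ℤ → ℤ → ℤ
𝟙≡ a b = if ⌊ a ℤ.≟ b ⌋ then + 1 else + 0

module Submission where

-- Shi's formula: the length of an affine permutation v is the statistic inversions v = Σ_{1≤a<b≤n} |⌊(v b − v a)/n⌋|.
-- Right multiplication by sᵢ raises it by one at an ascent (v i < v (i+1)) and lowers it by one at a descent, so it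
-- is at most the length of any word for v; conversely, following descents reaches in that many steps a permutation
-- without descents, which is the identity.  The hypotheses ℓ(sᵢw) = ℓ(wsᵢ) = ℓ(w) + 1 then say that w and w⁻¹ both
-- increase on the window 1..n.  Writing w i = ρᵢ + aᵢn + 1 with 0 ≤ ρᵢ < n (so aᵢ = λᵢ(w)), the quotient
-- ⌊(w j − w i)/n⌋ is aⱼ − aᵢ when ρᵢ < ρⱼ, and monotonicity of w⁻¹ forces this to be 0; when ρᵢ > ρⱼ it is
-- aⱼ − aᵢ − 1 ≥ 0.  Either way it equals max(aⱼ − aᵢ − 1, 0) = aⱼ − aᵢ + 𝟙(aᵢ = aⱼ) − 1.

open import Defs
open import Data.Nat as ℕ using (ℕ; zero; suc; z≤n; s≤s; _∸_; _≤_; _<_; NonZero)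
import Data.Nat.Properties as ℕP
import Data.Nat.DivMod as ℕD
open import Data.Nat.Combinatorics using (_C_; nC1≡n; nCk+nC[k+1]≡[n+1]C[k+1])
open import Data.Integer as ℤ using (ℤ; +_; -[1+_]; _+_; _-_; _*_; -_; ∣_∣; _⊔_; _/ℕ_; _%ℕ_)
import Data.Integer.Properties as ℤP
open import Data.Integer.DivMod using (a≡a%ℕn+[a/ℕn]*n; n%ℕd<d; [n/ℕd]*d≤n; n<s[n/ℕd]*d)
open import Data.Integer.Tactic.RingSolver using (solve-∀)
open import Algebra.Properties.AbelianGroup ℤP.+-0-abelianGroup using (∙-cancelʳ)
open import Algebra.Properties.CommutativeSemigroup ℤP.+-commutativeSemigroup
  using () renaming (xy∙z≈xz∙y to +-right-comm)
open import Data.Bool using (if_then_else_)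
open import Data.Empty using (⊥-elim)
open import Data.Fin using (Fin; toℕ; fromℕ<)
import Data.Fin.Properties as FP
open import Data.List using (List; []; _∷_; _++_; _∷ʳ_; length; reverse)
import Data.List.Properties as LP
open import Data.Product using (Σ; _×_; _,_; proj₁; proj₂; map)
open import Data.Sum using (_⊎_; inj₁; inj₂)
open import Function using (_∘_)
open import Function.Definitions using (Injective)
open import Relation.Binary.Definitions using (tri<; tri≈; tri>)
open import Relation.Binary.PropositionalEquality
open import Relation.Nullary using (¬_; Dec; yes; no)
open import Relation.Nullary.Decidable using (⌊_⌋)

-- Integer arithmetic

i<suc[j]⇒i≤j : ∀ {i j} → i ℤ.< ℤ.suc j → i ℤ.≤ j
i<suc[j]⇒i≤j {i} {j} i<1+j = subst (i ℤ.≤_) (ℤP.pred-suc j) (ℤP.i<j⇒i≤pred[j] i<1+j)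

i+1-1≡i : ∀ i → i + + 1 - + 1 ≡ i
i+1-1≡i = solve-∀

i-1+1≡i : ∀ i → i - + 1 + + 1 ≡ i
i-1+1≡i = solve-∀

<-shift : ∀ {a b} c {x y} → a ℤ.< b → a + c ≡ x → b + c ≡ y → x ℤ.< y
<-shift c a<b refl refl = ℤP.+-monoˡ-< c a<b

≤-shift : ∀ {a b} c {x y} → a ℤ.≤ b → a + c ≡ x → b + c ≡ y → x ℤ.≤ y
≤-shift c a≤b refl refl = ℤP.+-monoˡ-≤ c a≤b

0≤i⇒i+1≢0 : ∀ {i} → + 0 ℤ.≤ i → i + + 1 ≢ + 0
0≤i⇒i+1≢0 {+ k} _ eq = ℕP.1+n≢0 (trans (ℕP.+-comm 1 k) (ℤP.+-injective eq))

-- Division by n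

module _ (n : ℕ) .{{_ : NonZero n}} where

  ≤⇒≤/ℕ : ∀ {a c} → c * + n ℤ.≤ a → c ℤ.≤ a /ℕ n
  ≤⇒≤/ℕ {a} c*n≤a =
    i<suc[j]⇒i≤j (ℤP.*-cancelʳ-<-nonNeg (+ n) (ℤP.≤-<-trans c*n≤a (n<s[n/ℕd]*d a n)))

  <⇒/ℕ< : ∀ {a c} → a ℤ.< c * + n → a /ℕ n ℤ.< c
  <⇒/ℕ< {a} a<c*n = ℤP.*-cancelʳ-<-nonNeg (+ n) (ℤP.≤-<-trans ([n/ℕd]*d≤n a n) a<c*n)

  0≤⇒0≤/ℕ : ∀ {a} → + 0 ℤ.≤ a → + 0 ℤ.≤ a /ℕ n
  0≤⇒0≤/ℕ {a} 0≤a = ≤⇒≤/ℕ (subst (ℤ._≤ a) (sym (ℤP.*-zeroˡ (+ n))) 0≤a)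

  <n⇒/ℕ<1 : ∀ {a} → a ℤ.< + n → a /ℕ n ℤ.< + 1
  <n⇒/ℕ<1 {a} a<n = <⇒/ℕ< (subst (a ℤ.<_) (sym (ℤP.*-identityˡ (+ n))) a<n)

  /ℕ-unique : ∀ {a q} → q * + n ℤ.≤ a → a ℤ.< ℤ.suc q * + n → a /ℕ n ≡ q
  /ℕ-unique lo hi = ℤP.≤-antisym (i<suc[j]⇒i≤j (<⇒/ℕ< hi)) (≤⇒≤/ℕ lo)

  /ℕ-of-rep : ∀ {a r} q → r < n → a ≡ + r + q * + n → a /ℕ n ≡ q
  /ℕ-of-rep {a} {r} q r<n refl = /ℕ-unique
    (ℤP.i≤j⇒i≤k+j (+ r) ℤP.≤-refl)
    (subst (+ r + q * + n ℤ.<_) (sym (ℤP.suc-* q (+ n))) (ℤP.+-monoˡ-< (q * + n) (ℤ.+<+ r<n)))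

  %ℕ-of-rep : ∀ {a r} q → r < n → a ≡ + r + q * + n → a %ℕ n ≡ r
  %ℕ-of-rep {a} {r} q r<n a≡ = ℤP.+-injective (∙-cancelʳ (q * + n) (+ (a %ℕ n)) (+ r) (begin
    + (a %ℕ n) + q * + n       ≡⟨ cong (λ z → + (a %ℕ n) + z * + n) (sym (/ℕ-of-rep q r<n a≡)) ⟩
    + (a %ℕ n) + a /ℕ n * + n  ≡⟨ sym (a≡a%ℕn+[a/ℕn]*n a n) ⟩
    a                          ≡⟨ a≡ ⟩
    + r + q * + n              ∎))
    where open ≡-Reasoning

-- Sums over 1 ≤ a ≤ m and over pairs 1 ≤ i < j ≤ n

ΣZ-cong : ∀ m {f g : ℕ → ℤ} → (∀ a → 1 ≤ a → a ≤ m → f a ≡ g a) → ΣZ m f ≡ ΣZ m g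
ΣZ-cong zero    f≗g = refl
ΣZ-cong (suc m) f≗g =
  cong₂ _+_ (ΣZ-cong m (λ a 1≤a a≤m → f≗g a 1≤a (ℕP.m≤n⇒m≤1+n a≤m)))
            (f≗g (suc m) (s≤s z≤n) ℕP.≤-refl)

ΣZ-+ : ∀ m (f g : ℕ → ℤ) → ΣZ m (λ a → f a + g a) ≡ ΣZ m f + ΣZ m g
ΣZ-+ zero    f g = refl
ΣZ-+ (suc m) f g = trans (cong (_+ (f (suc m) + g (suc m))) (ΣZ-+ m f g))
                         (swap-middle (ΣZ m f) (ΣZ m g) (f (suc m)) (g (suc m)))
  where
  swap-middle : ∀ a b c d → (a + b) + (c + d) ≡ (a + c) + (b + d)
  swap-middle = solve-∀

ΣZ-neg : ∀ m (f : ℕ → ℤ) → ΣZ m (λ a → - f a) ≡ - ΣZ m f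
ΣZ-neg zero    f = refl
ΣZ-neg (suc m) f =
  trans (cong (_+ - f (suc m)) (ΣZ-neg m f)) (sym (ℤP.neg-distrib-+ (ΣZ m f) (f (suc m))))

ΣZ-- : ∀ m (f g : ℕ → ℤ) → ΣZ m (λ a → f a - g a) ≡ ΣZ m f - ΣZ m g
ΣZ-- m f g = trans (ΣZ-+ m f (λ a → - g a)) (cong (λ z → ΣZ m f + z) (ΣZ-neg m g))

ΣZ-const : ∀ m c → ΣZ m (λ _ → c) ≡ + m * c
ΣZ-const zero    c = sym (ℤP.*-zeroˡ c)
ΣZ-const (suc m) c =
  trans (cong (_+ c) (ΣZ-const m c)) (sym (trans (ℤP.suc-* (+ m) c) (ℤP.+-comm c (+ m * c))))

ΣZ-nonNeg : ∀ m {f : ℕ → ℤ} → (∀ a → + 0 ℤ.≤ f a) → + 0 ℤ.≤ ΣZ m f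
ΣZ-nonNeg zero    f≥0 = ℤP.≤-refl
ΣZ-nonNeg (suc m) f≥0 = ℤP.+-mono-≤ (ΣZ-nonNeg m f≥0) (f≥0 (suc m))

ΣZ-update : ∀ m p {f g : ℕ → ℤ} → 1 ≤ p → p ≤ m →
  (∀ a → 1 ≤ a → a ≤ m → a ≢ p → g a ≡ f a) → ΣZ m g ≡ ΣZ m f + (g p - f p)
ΣZ-update zero    p 1≤p p≤0 _ = ⊥-elim (ℕP.<-irrefl refl (ℕP.≤-trans 1≤p p≤0))
ΣZ-update (suc m) p {f} {g} 1≤p p≤ g≗f with p ℕ.≟ suc m
... | yes refl = trans (cong (_+ g (suc m)) (ΣZ-cong m below)) (shift (ΣZ m f) (f (suc m)) (g (suc m)))
  where
  below : ∀ a → 1 ≤ a → a ≤ m → g a ≡ f a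
  below a 1≤a a≤m = g≗f a 1≤a (ℕP.m≤n⇒m≤1+n a≤m) (ℕP.<⇒≢ (s≤s a≤m))
  shift : ∀ a b c → a + c ≡ (a + b) + (c - b)
  shift = solve-∀
... | no p≢ = trans (cong₂ _+_ (ΣZ-update m p 1≤p (ℕP.≤-pred (ℕP.≤∧≢⇒< p≤ p≢)) below) top)
                   (shift (ΣZ m f) (g p - f p) (f (suc m)))
  where
  below : ∀ a → 1 ≤ a → a ≤ m → a ≢ p → g a ≡ f a
  below a 1≤a a≤m = g≗f a 1≤a (ℕP.m≤n⇒m≤1+n a≤m)
  top : g (suc m) ≡ f (suc m)
  top = g≗f (suc m) (s≤s z≤n) ℕP.≤-refl (p≢ ∘ sym)
  shift : ∀ a b c → (a + b) + c ≡ (a + c) + b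
  shift = solve-∀

ΣZ-update₂ : ∀ m p q {f g : ℕ → ℤ} → 1 ≤ p → p ≤ m → 1 ≤ q → q ≤ m → p ≢ q →
  (∀ a → 1 ≤ a → a ≤ m → a ≢ p → a ≢ q → g a ≡ f a) →
  ΣZ m g ≡ ΣZ m f + (g p - f p) + (g q - f q)
ΣZ-update₂ m p q {f} {g} 1≤p p≤m 1≤q q≤m p≢q g≗f = begin
  ΣZ m g                              ≡⟨ ΣZ-update m q 1≤q q≤m g≗h ⟩
  ΣZ m h + (g q - h q)                ≡⟨ cong (λ z → z + (g q - h q)) (ΣZ-update m p 1≤p p≤m h≗f) ⟩
  ΣZ m f + (h p - f p) + (g q - h q)  ≡⟨ cong₂ (λ x y → ΣZ m f + (x - f p) + (g q - y)) hp hq ⟩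
  ΣZ m f + (g p - f p) + (g q - f q)  ∎
  where
  open ≡-Reasoning
  h : ℕ → ℤ
  h a = if ⌊ a ℕ.≟ q ⌋ then f a else g a
  hp : h p ≡ g p
  hp with p ℕ.≟ q
  ... | yes p≡q = ⊥-elim (p≢q p≡q)
  ... | no _    = refl
  hq : h q ≡ f q
  hq with q ℕ.≟ q
  ... | yes _   = refl
  ... | no q≢q = ⊥-elim (q≢q refl)
  g≗h : ∀ a → 1 ≤ a → a ≤ m → a ≢ q → g a ≡ h a
  g≗h a _ _ a≢q with a ℕ.≟ q
  ... | yes a≡q = ⊥-elim (a≢q a≡q)
  ... | no _    = refl
  h≗f : ∀ a → 1 ≤ a → a ≤ m → a ≢ p → h a ≡ f a
  h≗f a 1≤a a≤m a≢p with a ℕ.≟ q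
  ... | yes _   = refl
  ... | no a≢q = g≗f a 1≤a a≤m a≢p a≢q

ΣZ-unfoldˡ : ∀ m (f : ℕ → ℤ) → ΣZ (suc m) f ≡ f 1 + ΣZ m (f ∘ suc)
ΣZ-unfoldˡ zero    f = ℤP.+-comm (+ 0) (f 1)
ΣZ-unfoldˡ (suc m) f = trans (cong (_+ f (suc (suc m))) (ΣZ-unfoldˡ m f)) (ℤP.+-assoc (f 1) _ _)

adjSwap : ℕ → ℕ → ℕ
adjSwap i a with a ℕ.≟ i | a ℕ.≟ suc i
... | yes _ | _     = suc i
... | no _  | yes _ = i
... | no _  | no _  = a

adjSwap-left : ∀ i → adjSwap i i ≡ suc i
adjSwap-left i with i ℕ.≟ i
... | yes _  = refl
... | no i≢i = ⊥-elim (i≢i refl)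

adjSwap-right : ∀ i → adjSwap i (suc i) ≡ i
adjSwap-right i with suc i ℕ.≟ i | suc i ℕ.≟ suc i
... | yes 1+i≡i | _       = ⊥-elim (ℕP.1+n≢n 1+i≡i)
... | no _      | yes _   = refl
... | no _      | no ne   = ⊥-elim (ne refl)

adjSwap-other : ∀ i a → a ≢ i → a ≢ suc i → adjSwap i a ≡ a
adjSwap-other i a a≢i a≢1+i with a ℕ.≟ i | a ℕ.≟ suc i
... | yes a≡i | _         = ⊥-elim (a≢i a≡i)
... | no _    | yes a≡1+i = ⊥-elim (a≢1+i a≡1+i)
... | no _    | no _      = refl

ΣZ-adjSwap : ∀ m i (f : ℕ → ℤ) → 1 ≤ i → suc i ≤ m → ΣZ m (f ∘ adjSwap i) ≡ ΣZ m f
ΣZ-adjSwap m i f 1≤i 1+i≤m = begin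
  ΣZ m (f ∘ adjSwap i)
    ≡⟨ ΣZ-update₂ m i (suc i) 1≤i (ℕP.<⇒≤ 1+i≤m) (s≤s z≤n) 1+i≤m (ℕP.<⇒≢ ℕP.≤-refl) fixed ⟩
  ΣZ m f + (f (adjSwap i i) - f i) + (f (adjSwap i (suc i)) - f (suc i))
    ≡⟨ cong₂ (λ x y → ΣZ m f + (f x - f i) + (f y - f (suc i))) (adjSwap-left i) (adjSwap-right i) ⟩
  ΣZ m f + (f (suc i) - f i) + (f i - f (suc i))
    ≡⟨ cancel (ΣZ m f) (f i) (f (suc i)) ⟩
  ΣZ m f ∎
  where
  open ≡-Reasoning
  fixed : ∀ a → 1 ≤ a → a ≤ m → a ≢ i → a ≢ suc i → f (adjSwap i a) ≡ f a
  fixed a _ _ a≢i a≢1+i = cong f (adjSwap-other i a a≢i a≢1+i)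
  cancel : ∀ s x y → s + (y - x) + (x - y) ≡ s
  cancel = solve-∀

column : (ℕ → ℕ → ℤ) → ℕ → ℤ
column F j = ΣZ (j ∸ 1) (λ i → F i j)

pairSum-cong : ∀ n {F G : ℕ → ℕ → ℤ} → (∀ i j → 1 ≤ i → i < j → j ≤ n → F i j ≡ G i j) →
               pairSum n F ≡ pairSum n G
pairSum-cong n F≗G = ΣZ-cong n λ where
  (suc j) _ j<n → ΣZ-cong j (λ i 1≤i i≤j → F≗G i (suc j) 1≤i (s≤s i≤j) j<n)

pairSum-+ : ∀ n (F G : ℕ → ℕ → ℤ) → pairSum n (λ i j → F i j + G i j) ≡ pairSum n F + pairSum n G
pairSum-+ n F G =
  trans (ΣZ-cong n (λ j _ _ → ΣZ-+ (j ∸ 1) (λ i → F i j) (λ i → G i j))) (ΣZ-+ n (column F) (column G))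

pairSum-one : ∀ n → pairSum n (λ _ _ → + 1) ≡ + (n C 2)
pairSum-one zero    = refl
pairSum-one (suc n) = begin
  pairSum n (λ _ _ → + 1) + ΣZ n (λ _ → + 1)
    ≡⟨ cong₂ _+_ (pairSum-one n) (trans (ΣZ-const n (+ 1)) (ℤP.*-identityʳ (+ n))) ⟩
  + (n C 2 ℕ.+ n)
    ≡⟨ cong +_ (trans (ℕP.+-comm (n C 2) n) (pascal n)) ⟩
  + (suc n C 2) ∎
  where
  open ≡-Reasoning
  pascal : ∀ n → n ℕ.+ n C 2 ≡ suc n C 2
  pascal n = trans (cong (ℕ._+ n C 2) (sym (nC1≡n n))) (nCk+nC[k+1]≡[n+1]C[k+1] n 1)

pairSum-sub-one : ∀ n (F : ℕ → ℕ → ℤ) → pairSum n (λ i j → F i j - + 1) ≡ pairSum n F - + (n C 2)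
pairSum-sub-one n F = begin
  pairSum n (λ i j → F i j - + 1)
    ≡⟨ pairSum-+ n F (λ _ _ → - + 1) ⟩
  pairSum n F + pairSum n (λ _ _ → - + 1)
    ≡⟨ cong (λ z → pairSum n F + z) (trans negate (cong -_ (pairSum-one n))) ⟩
  pairSum n F - + (n C 2) ∎
  where
  open ≡-Reasoning
  negate : pairSum n (λ _ _ → - + 1) ≡ - pairSum n (λ _ _ → + 1)
  negate = trans (ΣZ-cong n (λ j _ _ → ΣZ-neg (j ∸ 1) (λ _ → + 1))) (ΣZ-neg n (column (λ _ _ → + 1)))

pairSum-adjSwap : ∀ n i (F G : ℕ → ℕ → ℤ) → 1 ≤ i → suc i ≤ n →
  (∀ a b → 1 ≤ a → a < b → b ≤ n → G a b ≡ F (adjSwap i a) (adjSwap i b)) →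
  pairSum n G ≡ pairSum n F + (F (suc i) i - F i (suc i))
pairSum-adjSwap n (suc i) F G _ 2+i≤n G≡F∘swap = begin
  ΣZ n (column G)
    ≡⟨ ΣZ-update₂ n I (suc I) (s≤s z≤n) 1+i≤n (s≤s z≤n) 2+i≤n (ℕP.<⇒≢ ℕP.≤-refl) other-columns ⟩
  ΣZ n (column F) + (column G I - Y) + (column G (suc I) - (X + q))
    ≡⟨ cong₂ (λ x y → ΣZ n (column F) + (x - Y) + (y - (X + q))) column-I column-1+I ⟩
  ΣZ n (column F) + (X - Y) + ((Y + p) - (X + q))
    ≡⟨ telescope (ΣZ n (column F)) X Y p q ⟩
  ΣZ n (column F) + (p - q) ∎
  where
  open ≡-Reasoning
  I = suc i
  X = ΣZ i (λ b → F b (suc I))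
  Y = ΣZ i (λ b → F b I)
  p = F (suc I) I
  q = F I (suc I)
  telescope : ∀ A X Y p q → A + (X - Y) + ((Y + p) - (X + q)) ≡ A + (p - q)
  telescope = solve-∀
  1+i≤n : I ≤ n
  1+i≤n = ℕP.<⇒≤ 2+i≤n
  fixed-below : ∀ b → b < I → adjSwap I b ≡ b
  fixed-below b b<I = adjSwap-other I b (ℕP.<⇒≢ b<I) (ℕP.<⇒≢ (ℕP.m<n⇒m<1+n b<I))
  column-I : column G I ≡ X
  column-I = ΣZ-cong i λ b 1≤b b≤i →
    trans (G≡F∘swap b I 1≤b (s≤s b≤i) 1+i≤n) (cong₂ F (fixed-below b (s≤s b≤i)) (adjSwap-left I))
  column-1+I : column G (suc I) ≡ Y + p
  column-1+I = cong₂ _+_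
    (ΣZ-cong i λ b 1≤b b≤i →
      trans (G≡F∘swap b (suc I) 1≤b (ℕP.m<n⇒m<1+n (s≤s b≤i)) 2+i≤n)
            (cong₂ F (fixed-below b (s≤s b≤i)) (adjSwap-right I)))
    (trans (G≡F∘swap I (suc I) (s≤s z≤n) ℕP.≤-refl 2+i≤n) (cong₂ F (adjSwap-left I) (adjSwap-right I)))
  other-columns : ∀ a → 1 ≤ a → a ≤ n → a ≢ I → a ≢ suc I → column G a ≡ column F a
  other-columns (suc a) _ a<n a≢I a≢1+I with ℕP.<-cmp (suc a) I
  ... | tri≈ _ a≡I _ = ⊥-elim (a≢I a≡I)
  ... | tri< a<I _ _ = ΣZ-cong a λ b 1≤b b≤a →
    trans (G≡F∘swap b (suc a) 1≤b (s≤s b≤a) a<n)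
          (cong₂ F (fixed-below b (ℕP.<-trans (s≤s b≤a) a<I)) (fixed-below (suc a) a<I))
  ... | tri> _ _ a>I = trans
    (ΣZ-cong a λ b 1≤b b≤a →
      trans (G≡F∘swap b (suc a) 1≤b (s≤s b≤a) a<n) (cong (F (adjSwap I b)) (adjSwap-other I (suc a) a≢I a≢1+I)))
    (ΣZ-adjSwap a I (λ b → F b (suc a)) (s≤s z≤n) (ℕP.≤-pred (ℕP.≤∧≢⇒< a>I (a≢1+I ∘ sym))))

-- How right multiplication by s₀ permutes the window pairs: s₀ sends 1 to 0 ≡ n and n to n + 1 ≡ 1 (mod n).
pairSum-swapEnds : ∀ n (F G : ℕ → ℕ → ℤ) → 2 ≤ n →
  (∀ j → 1 < j → j < n → G 1 j ≡ F j n) →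
  (∀ j → 1 < j → j < n → G j n ≡ F 1 j) →
  (∀ a b → 1 < a → a < b → b < n → G a b ≡ F a b) →
  pairSum n G ≡ pairSum n F + (G 1 n - F 1 n)
pairSum-swapEnds (suc zero) F G (s≤s ()) _ _ _
pairSum-swapEnds (suc (suc m)) F G _ G1j≡Fjn Gjn≡F1j G≡F = begin
  ΣZ (suc m) (column G) + ΣZ (suc m) (λ a → G a N)
    ≡⟨ cong₂ _+_ (drop-first-column G) (ΣZ-unfoldˡ m (λ a → G a N)) ⟩
  ΣZ m (column G ∘ suc) + (G 1 N + ΣZ m (λ b → G (suc b) N))
    ≡⟨ cong₂ (λ x y → x + (G 1 N + y)) inner-columns last-column ⟩
  (inner + (colₙ - row₁)) + (G 1 N + row₁)
    ≡⟨ regroup inner colₙ row₁ (G 1 N) (F 1 N) ⟩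
  (inner + (F 1 N + colₙ)) + (G 1 N - F 1 N)
    ≡⟨ cong (_+ (G 1 N - F 1 N)) (sym (cong₂ _+_ (drop-first-column F) (ΣZ-unfoldˡ m (λ a → F a N)))) ⟩
  (ΣZ (suc m) (column F) + ΣZ (suc m) (λ a → F a N)) + (G 1 N - F 1 N) ∎
  where
  open ≡-Reasoning
  N = suc (suc m)
  row₁ = ΣZ m (λ b → F 1 (suc b))
  colₙ = ΣZ m (λ b → F (suc b) N)
  inner = ΣZ m (column F ∘ suc)
  regroup : ∀ C B A g f → (C + (B - A)) + (g + A) ≡ (C + (f + B)) + (g - f)
  regroup = solve-∀
  drop-first-column : ∀ H → ΣZ (suc m) (column H) ≡ ΣZ m (column H ∘ suc)
  drop-first-column H = trans (ΣZ-unfoldˡ m (column H)) (ℤP.+-identityˡ _)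
  last-column : ΣZ m (λ b → G (suc b) N) ≡ row₁
  last-column = ΣZ-cong m (λ b 1≤b b≤m → Gjn≡F1j (suc b) (s≤s 1≤b) (s≤s (s≤s b≤m)))
  column-1+b : ∀ b → 1 ≤ b → b ≤ m → column G (suc b) ≡ column F (suc b) + (F (suc b) N - F 1 (suc b))
  column-1+b b 1≤b b≤m = trans
    (ΣZ-update b 1 (s≤s z≤n) 1≤b λ a 1≤a a≤b a≢1 →
      G≡F a (suc b) (ℕP.≤∧≢⇒< 1≤a (a≢1 ∘ sym)) (s≤s a≤b) (s≤s (s≤s b≤m)))
    (cong (λ z → column F (suc b) + (z - F 1 (suc b))) (G1j≡Fjn (suc b) (s≤s 1≤b) (s≤s (s≤s b≤m))))
  inner-columns : ΣZ m (column G ∘ suc) ≡ inner + (colₙ - row₁)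
  inner-columns = begin
    ΣZ m (column G ∘ suc)                                         ≡⟨ ΣZ-cong m column-1+b ⟩
    ΣZ m (λ b → column F (suc b) + (F (suc b) N - F 1 (suc b)))  ≡⟨ ΣZ-+ m (column F ∘ suc) _ ⟩
    inner + ΣZ m (λ b → F (suc b) N - F 1 (suc b))               ≡⟨ cong (λ z → inner + z) (ΣZ-- m _ _) ⟩
    inner + (colₙ - row₁)                                         ∎

𝟙≡-equal : ∀ {a b} → a ≡ b → 𝟙≡ a b ≡ + 1
𝟙≡-equal {a} {b} a≡b with a ℤ.≟ b
... | yes _  = refl
... | no a≢b = ⊥-elim (a≢b a≡b)

𝟙≡-distinct : ∀ {a b} → a ≢ b → 𝟙≡ a b ≡ + 0
𝟙≡-distinct {a} {b} a≢b with a ℤ.≟ b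
... | yes a≡b = ⊥-elim (a≢b a≡b)
... | no _    = refl

shi-term-equal : ∀ a b → b - a ≡ + 0 → (+ 0 ≡ (b - a - + 1) ⊔ + 0) × (+ 0 ≡ b - a + 𝟙≡ a b - + 1)
shi-term-equal a b b-a≡0 =
  sym (cong (λ t → (t - + 1) ⊔ + 0) b-a≡0) ,
  sym (cong₂ (λ t e → t + e - + 1) b-a≡0 (𝟙≡-equal (sym (ℤP.i-j≡0⇒i≡j b a b-a≡0))))

shi-term-apart : ∀ a b → + 0 ℤ.≤ b - a - + 1 →
  (+ ∣ b - a - + 1 ∣ ≡ (b - a - + 1) ⊔ + 0) × (+ ∣ b - a - + 1 ∣ ≡ b - a + 𝟙≡ a b - + 1)
shi-term-apart a b 0≤t =
  trans t≡ (sym (ℤP.i≥j⇒i⊔j≡i 0≤t)) ,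
  trans t≡ (sym (trans (cong (λ e → b - a + e - + 1) (𝟙≡-distinct a≢b)) (drop+0 (b - a))))
  where
  t≡ : + ∣ b - a - + 1 ∣ ≡ b - a - + 1
  t≡ = ℤP.0≤i⇒+∣i∣≡i 0≤t
  drop+0 : ∀ x → x + + 0 - + 1 ≡ x - + 1
  drop+0 = solve-∀
  a≢b : a ≢ b
  a≢b refl = ℤP.<⇒≱ (ℤ.-<+ {0} {0}) (subst (λ t → + 0 ℤ.≤ t - + 1) (ℤP.+-inverseʳ a) 0≤t)

adjacent⇒increasing : ∀ {m} (f : ℤ → ℤ) → (∀ i → 1 ≤ i → i < m → f (+ i) ℤ.< f (+ suc i)) →
  ∀ i j → 1 ≤ i → i < j → j ≤ m → f (+ i) ℤ.< f (+ j)
adjacent⇒increasing f step i (suc j) 1≤i i<1+j 1+j≤m with ℕP.m≤n⇒m<n∨m≡n (ℕP.≤-pred i<1+j)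
... | inj₂ refl = step i 1≤i 1+j≤m
... | inj₁ i<j  =
  ℤP.<-trans (adjacent⇒increasing f step i j 1≤i i<j (ℕP.<⇒≤ 1+j≤m))
             (step j (ℕP.≤-trans 1≤i (ℕP.<⇒≤ i<j)) 1+j≤m)

-- Generators, periodic functions and the inversion statistic

module _ (n : ℕ) .{{_ : NonZero n}} where

  %ℕ-+n : ∀ x → (x + + n) %ℕ n ≡ x %ℕ n
  %ℕ-+n x = %ℕ-of-rep n (x /ℕ n + + 1) (n%ℕd<d x n)
    (trans (cong (_+ + n) (a≡a%ℕn+[a/ℕn]*n x n)) (absorb (+ (x %ℕ n)) (x /ℕ n) (+ n)))
    where
    absorb : ∀ r q n → r + q * n + n ≡ r + (q + + 1) * n
    absorb = solve-∀

  %-of-≤ : ∀ {j} → j ≤ n → (j ℕ.% n ≡ j × j < n) ⊎ (j ℕ.% n ≡ 0 × j ≡ n)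
  %-of-≤ j≤n with ℕP.m≤n⇒m<n∨m≡n j≤n
  ... | inj₁ j<n  = inj₁ (ℕD.m<n⇒m%n≡m j<n , j<n)
  ... | inj₂ refl = inj₂ (ℕD.n%n≡0 n , refl)

  x+1≡[1+x%n]+[x/n]*n : ∀ x → x + + 1 ≡ + suc (x %ℕ n) + x /ℕ n * + n
  x+1≡[1+x%n]+[x/n]*n x = trans (cong (_+ + 1) (a≡a%ℕn+[a/ℕn]*n x n)) (rearrange (+ (x %ℕ n)) (x /ℕ n * + n))
    where
    rearrange : ∀ a b → a + b + + 1 ≡ (+ 1 + a) + b
    rearrange = solve-∀

  %ℕ-+1 : ∀ x → (x + + 1) %ℕ n ≡ suc (x %ℕ n) ℕ.% n
  %ℕ-+1 x with %-of-≤ (n%ℕd<d x n)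
  ... | inj₁ (1+r%n≡1+r , 1+r<n) = trans (%ℕ-of-rep n (x /ℕ n) 1+r<n (x+1≡[1+x%n]+[x/n]*n x)) (sym 1+r%n≡1+r)
  ... | inj₂ (1+r%n≡0 , 1+r≡n) =
    trans (%ℕ-of-rep n (x /ℕ n + + 1) (subst (0 <_) 1+r≡n (s≤s z≤n)) x+1≡) (sym 1+r%n≡0)
    where
    x+1≡ : x + + 1 ≡ + 0 + (x /ℕ n + + 1) * + n
    x+1≡ = trans (x+1≡[1+x%n]+[x/n]*n x)
             (trans (cong (λ z → + z + x /ℕ n * + n) 1+r≡n) (absorb (x /ℕ n) (+ n)))
      where
      absorb : ∀ q n → n + q * n ≡ + 0 + (q + + 1) * n
      absorb = solve-∀

  s-up : ∀ i x → x %ℕ n ≡ i ℕ.% n → s n i x ≡ x + + 1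
  s-up i x x≡i with (x %ℕ n) ℕ.≟ (i ℕ.% n)
  ... | yes _  = refl
  ... | no x≢i = ⊥-elim (x≢i x≡i)

  s-down : ∀ i x → x %ℕ n ≢ i ℕ.% n → x %ℕ n ≡ suc i ℕ.% n → s n i x ≡ x - + 1
  s-down i x x≢i x≡1+i with (x %ℕ n) ℕ.≟ (i ℕ.% n) | (x %ℕ n) ℕ.≟ (suc i ℕ.% n)
  ... | yes x≡i | _          = ⊥-elim (x≢i x≡i)
  ... | no _    | yes _      = refl
  ... | no _    | no x≢1+i   = ⊥-elim (x≢1+i x≡1+i)

  s-fix : ∀ i x → x %ℕ n ≢ i ℕ.% n → x %ℕ n ≢ suc i ℕ.% n → s n i x ≡ x
  s-fix i x x≢i x≢1+i with (x %ℕ n) ℕ.≟ (i ℕ.% n) | (x %ℕ n) ℕ.≟ (suc i ℕ.% n)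
  ... | yes x≡i | _         = ⊥-elim (x≢i x≡i)
  ... | no _    | yes x≡1+i = ⊥-elim (x≢1+i x≡1+i)
  ... | no _    | no _      = refl

  s-at-i : ∀ i → s n i (+ i) ≡ + suc i
  s-at-i i = trans (s-up i (+ i) refl) (cong +_ (ℕP.+-comm i 1))

  s-periodic : ∀ i x → s n i (x + + n) ≡ s n i x + + n
  s-periodic i x with (x %ℕ n) ℕ.≟ (i ℕ.% n) | (x %ℕ n) ℕ.≟ (suc i ℕ.% n)
  ... | yes x≡i | _ = trans (s-up i (x + + n) (trans (%ℕ-+n x) x≡i)) (+-right-comm x (+ n) (+ 1))
  ... | no x≢i | yes x≡1+i =
    trans (s-down i (x + + n) (x≢i ∘ trans (sym (%ℕ-+n x))) (trans (%ℕ-+n x) x≡1+i)) (+-right-comm x (+ n) (- + 1))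
  ... | no x≢i | no x≢1+i =
    s-fix i (x + + n) (x≢i ∘ trans (sym (%ℕ-+n x))) (x≢1+i ∘ trans (sym (%ℕ-+n x)))

  Periodic : (ℤ → ℤ) → Set
  Periodic v = ∀ x → v (x + + n) ≡ v x + + n

  module _ {v : ℤ → ℤ} (periodic : Periodic v) where

    periodic-+ : ∀ x k → v (x + + k * + n) ≡ v x + + k * + n
    periodic-+ x zero    = trans (cong v (+0 x (+ n))) (sym (+0 (v x) (+ n)))
      where
      +0 : ∀ a n → a + + 0 * n ≡ a
      +0 = solve-∀
    periodic-+ x (suc k) = begin
      v (x + + suc k * + n)        ≡⟨ cong v (split x (+ k) (+ n)) ⟩
      v (x + + k * + n + + n)      ≡⟨ periodic _ ⟩
      v (x + + k * + n) + + n      ≡⟨ cong (_+ + n) (periodic-+ x k) ⟩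
      v x + + k * + n + + n        ≡⟨ sym (split (v x) (+ k) (+ n)) ⟩
      v x + + suc k * + n          ∎
      where
      open ≡-Reasoning
      split : ∀ a k n → a + (+ 1 + k) * n ≡ a + k * n + n
      split = solve-∀

    periodic-* : ∀ x q → v (x + q * + n) ≡ v x + q * + n
    periodic-* x (+ k)      = periodic-+ x k
    periodic-* x -[1+ k ] = begin
      v y                              ≡⟨ sym (shift-back (v y) (+ suc k) (+ n)) ⟩
      v y + + suc k * + n - + suc k * + n ≡⟨ cong (_- + suc k * + n) (sym (periodic-+ y (suc k))) ⟩
      v (y + + suc k * + n) - + suc k * + n ≡⟨ cong (λ z → v z - + suc k * + n) (undo x (+ suc k) (+ n)) ⟩
      v x - + suc k * + n              ≡⟨ neg-* (v x) (+ suc k) (+ n) ⟩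
      v x + -[1+ k ] * + n             ∎
      where
      open ≡-Reasoning
      y = x + -[1+ k ] * + n
      shift-back : ∀ a b c → a + b * c - b * c ≡ a
      shift-back = solve-∀
      undo : ∀ a b c → a + (- b) * c + b * c ≡ a
      undo = solve-∀
      neg-* : ∀ a b c → a - b * c ≡ a + (- b) * c
      neg-* = solve-∀

  periodic-0 : ∀ {v : ℤ → ℤ} → Periodic v → v (+ 0) ≡ v (+ n) - + n
  periodic-0 {v} periodic = trans (sym (i+j-j≡i (v (+ 0)) (+ n))) (cong (_- + n) (sym (periodic (+ 0))))
    where
    i+j-j≡i : ∀ i j → i + j - j ≡ i
    i+j-j≡i = solve-∀

  ∘s-periodic : ∀ {v : ℤ → ℤ} i → Periodic v → Periodic (v ∘ s n i)
  ∘s-periodic {v} i periodic x = trans (cong v (s-periodic i x)) (periodic _)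

  window-differences-%ℕ≢0 : ∀ {v : ℤ → ℤ} → Periodic v → Injective _≡_ _≡_ v →
    ∀ {a b} → 1 ≤ a → a ≤ n → 1 ≤ b → b ≤ n → a ≢ b → (v (+ b) - v (+ a)) %ℕ n ≢ 0
  window-differences-%ℕ≢0 {v} periodic injective {suc a} {suc b} _ a<n _ b<n a≢b D%n≡0 =
    a≢b (cong suc (ℤP.+-injective a≡b))
    where
    open ≡-Reasoning
    D = v (+ suc b) - v (+ suc a)
    q = D /ℕ n
    pad : ∀ a n → a ≡ a + + 0 * n
    pad = solve-∀
    D≡q*n : D ≡ q * + n
    D≡q*n = trans (a≡a%ℕn+[a/ℕn]*n D n) (trans (cong (λ r → + r + q * + n) D%n≡0) (ℤP.+-identityˡ _))
    v[1+b]≡ : v (+ suc b) ≡ v (+ suc a + q * + n)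
    v[1+b]≡ = begin
      v (+ suc b)              ≡⟨ i≡j+[i-j] (v (+ suc b)) (v (+ suc a)) ⟩
      v (+ suc a) + D          ≡⟨ cong (λ z → v (+ suc a) + z) D≡q*n ⟩
      v (+ suc a) + q * + n    ≡⟨ sym (periodic-* {v} periodic (+ suc a) q) ⟩
      v (+ suc a + q * + n)    ∎
      where
      i≡j+[i-j] : ∀ i j → i ≡ j + (i - j)
      i≡j+[i-j] = solve-∀
    b≡a+q*n : + b ≡ + a + q * + n
    b≡a+q*n = trans (cong (_- + 1) (injective v[1+b]≡)) (drop-1 (+ a) q (+ n))
      where
      drop-1 : ∀ a q n → + 1 + a + q * n - + 1 ≡ a + q * n
      drop-1 = solve-∀
    q≡0 : q ≡ + 0
    q≡0 = trans (sym (/ℕ-of-rep n q a<n b≡a+q*n)) (/ℕ-of-rep n (+ 0) b<n (pad (+ b) (+ n)))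
    a≡b : + a ≡ + b
    a≡b = begin
      + a              ≡⟨ pad (+ a) (+ n) ⟩
      + a + + 0 * + n  ≡⟨ cong (λ z → + a + z * + n) (sym q≡0) ⟩
      + a + q * + n    ≡⟨ sym b≡a+q*n ⟩
      + b              ∎

  -- For D = v b − v a this counts the inversions of v between the residue classes of a and b.
  classInversions : ℤ → ℤ
  classInversions D = + ∣ D /ℕ n ∣

  inversionsBetween : (ℤ → ℤ) → ℕ → ℕ → ℤ
  inversionsBetween v a b = classInversions (v (+ b) - v (+ a))

  inversions : (ℤ → ℤ) → ℤ
  inversions v = pairSum n (inversionsBetween v)

  module _ (D : ℤ) (D%n≢0 : D %ℕ n ≢ 0) where

    private
      r = D %ℕ n
      0<r : 0 < r
      0<r = ℕP.n≢0⇒n>0 D%n≢0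
      n∸r<n : n ∸ r < n
      n∸r<n = ℕP.∸-monoʳ-< 0<r (ℕP.<⇒≤ (n%ℕd<d D n))

      reflect-rep : ∀ k → k * + n - D ≡ + (n ∸ r) + (k - + 1 - D /ℕ n) * + n
      reflect-rep k = begin
        k * + n - D
          ≡⟨ cong (λ z → k * + n - z) (a≡a%ℕn+[a/ℕn]*n D n) ⟩
        k * + n - (+ r + D /ℕ n * + n)
          ≡⟨ cong (λ m → k * m - (+ r + D /ℕ n * m)) (sym n≡) ⟩
        k * (+ (n ∸ r) + + r) - (+ r + D /ℕ n * (+ (n ∸ r) + + r))
          ≡⟨ rearrange (+ (n ∸ r)) (+ r) (D /ℕ n) k ⟩
        + (n ∸ r) + (k - + 1 - D /ℕ n) * (+ (n ∸ r) + + r)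
          ≡⟨ cong (λ m → + (n ∸ r) + (k - + 1 - D /ℕ n) * m) n≡ ⟩
        + (n ∸ r) + (k - + 1 - D /ℕ n) * + n ∎
        where
        open ≡-Reasoning
        n≡ : + (n ∸ r) + + r ≡ + n
        n≡ = cong +_ (ℕP.m∸n+n≡m (ℕP.<⇒≤ (n%ℕd<d D n)))
        rearrange : ∀ X r q k → k * (X + r) - (r + q * (X + r)) ≡ X + (k - + 1 - q) * (X + r)
        rearrange = solve-∀

    /ℕ-reflect : ∀ k → (k * + n - D) /ℕ n ≡ k - + 1 - D /ℕ n
    /ℕ-reflect k = /ℕ-of-rep n (k - + 1 - D /ℕ n) n∸r<n (reflect-rep k)

    classInversions-neg : + 0 ℤ.< D → classInversions (- D) ≡ classInversions D + + 1
    classInversions-neg 0<D = begin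
      + ∣ (- D) /ℕ n ∣                      ≡⟨ cong (λ z → + ∣ z /ℕ n ∣) (-D≡0*n-D D) ⟩
      + ∣ (+ 0 * + n - D) /ℕ n ∣            ≡⟨ cong (λ z → + ∣ z ∣) (/ℕ-reflect (+ 0)) ⟩
      + ∣ + 0 - + 1 - D /ℕ n ∣              ≡⟨ ∣-1-q∣ (D /ℕ n) (0≤⇒0≤/ℕ n (ℤP.<⇒≤ 0<D)) ⟩
      + ∣ D /ℕ n ∣ + + 1                    ∎
      where
      open ≡-Reasoning
      -D≡0*n-D : ∀ D → - D ≡ + 0 * + n - D
      -D≡0*n-D D = sym (trans (cong (_- D) (ℤP.*-zeroˡ (+ n))) (ℤP.+-identityˡ (- D)))
      ∣-1-q∣ : ∀ q → + 0 ℤ.≤ q → + ∣ + 0 - + 1 - q ∣ ≡ + ∣ q ∣ + + 1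
      ∣-1-q∣ (+ zero)  _ = refl
      ∣-1-q∣ (+ suc k) _ = cong +_ (ℕP.+-comm 1 (suc k))

    classInversions-shift : classInversions (+ n - D) ≡ classInversions D
    classInversions-shift = begin
      + ∣ (+ n - D) /ℕ n ∣        ≡⟨ cong (λ z → + ∣ (z - D) /ℕ n ∣) (sym (ℤP.*-identityˡ (+ n))) ⟩
      + ∣ (+ 1 * + n - D) /ℕ n ∣            ≡⟨ cong (λ z → + ∣ z ∣) (/ℕ-reflect (+ 1)) ⟩
      + ∣ + 1 - + 1 - D /ℕ n ∣              ≡⟨ cong (λ z → + ∣ z ∣) (1-1-q≡-q (D /ℕ n)) ⟩
      + ∣ - (D /ℕ n) ∣                      ≡⟨ cong +_ (ℤP.∣-i∣≡∣i∣ (D /ℕ n)) ⟩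
      + ∣ D /ℕ n ∣                          ∎
      where
      open ≡-Reasoning
      1-1-q≡-q : ∀ q → + 1 - + 1 - q ≡ - q
      1-1-q≡-q = solve-∀

    classInversions-reflect₂ : D ℤ.< + n → classInversions (+ n + + n - D) ≡ classInversions D + + 1
    classInversions-reflect₂ D<n = begin
      + ∣ (+ n + + n - D) /ℕ n ∣            ≡⟨ cong (λ z → + ∣ (z - D) /ℕ n ∣) (2n≡2*n (+ n)) ⟩
      + ∣ (+ 2 * + n - D) /ℕ n ∣            ≡⟨ cong (λ z → + ∣ z ∣) (/ℕ-reflect (+ 2)) ⟩
      + ∣ + 2 - + 1 - D /ℕ n ∣              ≡⟨ ∣1-q∣ (D /ℕ n) (<n⇒/ℕ<1 n D<n) ⟩
      + ∣ D /ℕ n ∣ + + 1                    ∎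
      where
      open ≡-Reasoning
      2n≡2*n : ∀ m → m + m ≡ + 2 * m
      2n≡2*n = solve-∀
      ∣1-q∣ : ∀ q → q ℤ.< + 1 → + ∣ + 2 - + 1 - q ∣ ≡ + ∣ q ∣ + + 1
      ∣1-q∣ (+ zero)   _ = refl
      ∣1-q∣ (+ suc k) (ℤ.+<+ (s≤s ()))
      ∣1-q∣ -[1+ k ]  _ = cong +_ (trans (ℕP.+-comm 2 k) (ℕP.+-suc k 1))

  inversions-nonNeg : ∀ v → + 0 ℤ.≤ inversions v
  inversions-nonNeg v = ΣZ-nonNeg n (λ j → ΣZ-nonNeg (j ∸ 1) (λ _ → ℤ.+≤+ z≤n))

  inversions-cong : ∀ {f h : ℤ → ℤ} → (∀ x → f x ≡ h x) → inversions f ≡ inversions h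
  inversions-cong f≗h = pairSum-cong n (λ a b _ _ _ → cong₂ (λ x y → classInversions (x - y)) (f≗h _) (f≗h _))

  HasWordOfLength : (ℤ → ℤ) → ℕ → Set
  HasWordOfLength v m = Σ (List (Fin n)) λ ws → length ws ≡ m × Represents n ws v

  evalWord-++ : ∀ (as bs : List (Fin n)) x → evalWord n (as ++ bs) x ≡ evalWord n as (evalWord n bs x)
  evalWord-++ []       bs x = refl
  evalWord-++ (a ∷ as) bs x = cong (s n (toℕ a)) (evalWord-++ as bs x)

  IsAffPerm-id : IsAffPerm n (λ x → x)
  IsAffPerm-id = record
    { injective  = λ x≡y → x≡y
    ; surjective = λ y → y , λ z≡y → z≡y
    ; periodic   = λ _ → refl
    ; windowSum  = refl
    }

  inversions-id : inversions (λ x → x) ≡ + 0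
  inversions-id = trans (pairSum-cong n window-gap) (ΣZ-const₀ n (λ j → ΣZ-const₀ (j ∸ 1) (λ _ → refl)))
    where
    ΣZ-const₀ : ∀ m {f : ℕ → ℤ} → (∀ a → f a ≡ + 0) → ΣZ m f ≡ + 0
    ΣZ-const₀ m {f} f≡0 = trans (ΣZ-cong m (λ a _ _ → f≡0 a)) (trans (ΣZ-const m (+ 0)) (ℤP.*-zeroʳ (+ m)))
    window-gap : ∀ a b → 1 ≤ a → a < b → b ≤ n → classInversions (+ b - + a) ≡ + 0
    window-gap a b 1≤a a<b b≤n = cong (λ q → + ∣ q ∣) (/ℕ-of-rep n (+ 0) b∸a<n b-a≡)
      where
      b∸a<n : b ∸ a < n
      b∸a<n = ℕP.<-≤-trans (ℕP.∸-monoʳ-< 1≤a (ℕP.<⇒≤ a<b)) b≤n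
      b-a≡ : + b - + a ≡ + (b ∸ a) + + 0 * + n
      b-a≡ = trans (ℤP.m-n≡m⊖n b a) (trans (ℤP.⊖-≥ (ℕP.<⇒≤ a<b)) (pad (+ (b ∸ a)) (+ n)))
        where
        pad : ∀ x n → x ≡ x + + 0 * n
        pad = solve-∀

  module _ {v : ℤ → ℤ} (v-aff : IsAffPerm n v) (ascending : ∀ i → i < n → v (+ i) ℤ.< v (+ suc i)) where

    private
      open IsAffPerm v-aff
      c = v (+ 0)

      gap : ∀ d j → j ℕ.+ d ≤ n → v (+ j) + + d ℤ.≤ v (+ (j ℕ.+ d))
      gap zero    j _ = ℤP.≤-reflexive (trans (ℤP.+-identityʳ _) (cong (λ z → v (+ z)) (sym (ℕP.+-identityʳ j))))
      gap (suc d) j j+1+d≤n = begin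
        v (+ j) + + suc d
          ≡⟨ rotate (v (+ j)) (+ d) ⟩
        + 1 + (v (+ j) + + d)
          ≤⟨ ℤP.+-monoʳ-≤ (+ 1) (gap d j (ℕP.≤-trans (ℕP.+-monoʳ-≤ j (ℕP.n≤1+n d)) j+1+d≤n)) ⟩
        + 1 + v (+ (j ℕ.+ d))
          ≤⟨ ℤP.i<j⇒suc[i]≤j (ascending (j ℕ.+ d) (subst (_≤ n) (ℕP.+-suc j d) j+1+d≤n)) ⟩
        v (+ suc (j ℕ.+ d))
          ≡⟨ cong (λ z → v (+ z)) (sym (ℕP.+-suc j d)) ⟩
        v (+ (j ℕ.+ suc d)) ∎
        where
        open ℤP.≤-Reasoning
        rotate : ∀ a d → a + (+ 1 + d) ≡ + 1 + (a + d)
        rotate = solve-∀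

      window-affine : ∀ j → j ≤ n → v (+ j) ≡ c + + j
      window-affine j j≤n = ℤP.≤-antisym upper (gap j 0 j≤n)
        where
        X = n ∸ j
        j+X≡n : j ℕ.+ X ≡ n
        j+X≡n = ℕP.m+[n∸m]≡n j≤n
        top : v (+ (j ℕ.+ X)) ≡ c + (+ j + + X)
        top = trans (cong (λ z → v (+ z)) j+X≡n) (trans (periodic (+ 0)) (cong (λ z → c + + z) (sym j+X≡n)))
        upper : v (+ j) ℤ.≤ c + + j
        upper = ≤-shift (- + X) (subst (v (+ j) + + X ℤ.≤_) top (gap X j (ℕP.≤-reflexive j+X≡n)))
                  (i+j-j≡i (v (+ j)) (+ X)) (regroup c (+ j) (+ X))
          where
          i+j-j≡i : ∀ i j → i + j - j ≡ i
          i+j-j≡i = solve-∀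
          regroup : ∀ c a x → c + (a + x) - x ≡ c + a
          regroup = solve-∀

      c≡0 : c ≡ + 0
      c≡0 = ℤP.*-cancelˡ-≡ (+ n) c (+ 0) (∙-cancelʳ S (+ n * c) (+ n * + 0) (begin
        + n * c + S                ≡⟨ sym (cong (_+ S) (ΣZ-const n c)) ⟩
        ΣZ n (λ _ → c) + S         ≡⟨ sym (ΣZ-+ n (λ _ → c) (λ j → + j)) ⟩
        ΣZ n (λ j → c + + j)       ≡⟨ sym (ΣZ-cong n (λ j _ j≤n → window-affine j j≤n)) ⟩
        ΣZ n (λ j → v (+ j))       ≡⟨ windowSum ⟩
        S                          ≡⟨ sym (trans (cong (_+ S) (ℤP.*-zeroʳ (+ n))) (ℤP.+-identityˡ S)) ⟩
        + n * + 0 + S              ∎))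
        where
        open ≡-Reasoning
        S = ΣZ n (λ j → + j)

    ascending⇒id : ∀ x → v x ≡ x
    ascending⇒id x = begin
      v x
        ≡⟨ cong v (a≡a%ℕn+[a/ℕn]*n x n) ⟩
      v (+ (x %ℕ n) + x /ℕ n * + n)
        ≡⟨ periodic-* {v} periodic (+ (x %ℕ n)) (x /ℕ n) ⟩
      v (+ (x %ℕ n)) + x /ℕ n * + n
        ≡⟨ cong (_+ x /ℕ n * + n) (window-affine (x %ℕ n) (ℕP.<⇒≤ (n%ℕd<d x n))) ⟩
      c + + (x %ℕ n) + x /ℕ n * + n
        ≡⟨ cong (λ z → z + + (x %ℕ n) + x /ℕ n * + n) c≡0 ⟩
      + (x %ℕ n) + x /ℕ n * + n
        ≡⟨ sym (a≡a%ℕn+[a/ℕn]*n x n) ⟩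
      x ∎
      where open ≡-Reasoning

  module _ (2≤n : 2 ≤ n) where

    1+i%n≢i : ∀ {i} → i < n → suc i ℕ.% n ≢ i
    1+i%n≢i {i} i<n 1+i%n≡i with %-of-≤ i<n
    ... | inj₁ (1+i%n≡1+i , _) = ℕP.1+n≢n (trans (sym 1+i%n≡1+i) 1+i%n≡i)
    ... | inj₂ (1+i%n≡0 , 1+i≡n) = ℕP.<⇒≢ 2≤n (trans (cong suc (sym (trans (sym 1+i%n≡i) 1+i%n≡0))) 1+i≡n)

    1+a%n-injective : ∀ {a b} → a < n → b < n → suc a ℕ.% n ≡ suc b ℕ.% n → a ≡ b
    1+a%n-injective a<n b<n eq with %-of-≤ a<n | %-of-≤ b<n
    ... | inj₁ (a' , _) | inj₁ (b' , _) = ℕP.suc-injective (trans (sym a') (trans eq b'))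
    ... | inj₁ (a' , _) | inj₂ (b' , _) = ⊥-elim (ℕP.1+n≢0 (trans (sym a') (trans eq b')))
    ... | inj₂ (a' , _) | inj₁ (b' , _) = ⊥-elim (ℕP.1+n≢0 (trans (sym b') (trans (sym eq) a')))
    ... | inj₂ (_ , a') | inj₂ (_ , b') = ℕP.suc-injective (trans a' (sym b'))

    s-involutive : ∀ i → i < n → ∀ x → s n i (s n i x) ≡ x
    s-involutive i i<n x with (x %ℕ n) ℕ.≟ (i ℕ.% n) | (x %ℕ n) ℕ.≟ (suc i ℕ.% n)
    ... | yes x≡i | _ = trans (s-down i (x + + 1) (1+i%n≢i i<n ∘ x+1≡i) x+1≡1+i) (i+1-1≡i x)
      where
      x+1≡1+i : (x + + 1) %ℕ n ≡ suc i ℕ.% n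
      x+1≡1+i = trans (%ℕ-+1 x) (cong (λ r → suc r ℕ.% n) (trans x≡i (ℕD.m<n⇒m%n≡m i<n)))
      x+1≡i : (x + + 1) %ℕ n ≡ i ℕ.% n → suc i ℕ.% n ≡ i
      x+1≡i e = trans (sym x+1≡1+i) (trans e (ℕD.m<n⇒m%n≡m i<n))
    ... | no x≢i | yes x≡1+i = trans (s-up i (x - + 1) x-1≡i) (i-1+1≡i x)
      where
      x-1≡i : (x - + 1) %ℕ n ≡ i ℕ.% n
      x-1≡i = trans (1+a%n-injective (n%ℕd<d (x - + 1) n) i<n
                      (trans (sym (%ℕ-+1 (x - + 1))) (trans (cong (_%ℕ n) (i-1+1≡i x)) x≡1+i)))
                    (sym (ℕD.m<n⇒m%n≡m i<n))
    ... | no x≢i | no x≢1+i = s-fix i x x≢i x≢1+i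

    s-at-1+i : ∀ {i} → i < n → s n i (+ suc i) ≡ + i
    s-at-1+i {i} i<n = s-down i (+ suc i) (λ 1+i≡i → 1+i%n≢i i<n (trans 1+i≡i (ℕD.m<n⇒m%n≡m i<n))) refl

    window-%-injective : ∀ {a b} → 1 ≤ a → a ≤ n → 1 ≤ b → b ≤ n → a ℕ.% n ≡ b ℕ.% n → a ≡ b
    window-%-injective 1≤a a≤n 1≤b b≤n eq with %-of-≤ a≤n | %-of-≤ b≤n
    ... | inj₁ (a' , _) | inj₁ (b' , _) = trans (sym a') (trans eq b')
    ... | inj₁ (a' , _) | inj₂ (b' , _) = ⊥-elim (ℕP.<⇒≢ 1≤a (sym (trans (sym a') (trans eq b'))))
    ... | inj₂ (a' , _) | inj₁ (b' , _) = ⊥-elim (ℕP.<⇒≢ 1≤b (sym (trans (sym b') (trans (sym eq) a'))))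
    ... | inj₂ (_ , a') | inj₂ (_ , b') = trans a' (sym b')

    s-window : ∀ i j → 1 ≤ i → suc i ≤ n → 1 ≤ j → j ≤ n → s n i (+ j) ≡ + adjSwap i j
    s-window i j 1≤i 1+i≤n 1≤j j≤n with j ℕ.≟ i | j ℕ.≟ suc i
    ... | yes refl | _ = s-at-i j
    ... | no j≢i | yes refl =
      s-down i (+ suc i) (j≢i ∘ window-%-injective 1≤j j≤n 1≤i (ℕP.<⇒≤ 1+i≤n)) refl
    ... | no j≢i | no j≢1+i =
      s-fix i (+ j) (j≢i ∘ window-%-injective 1≤j j≤n 1≤i (ℕP.<⇒≤ 1+i≤n))
                    (j≢1+i ∘ window-%-injective 1≤j j≤n (s≤s z≤n) 1+i≤n)

    0%n≡n%n : 0 ℕ.% n ≡ n ℕ.% n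
    0%n≡n%n = trans (ℕD.m<n⇒m%n≡m (ℕP.<-trans (s≤s z≤n) 2≤n)) (sym (ℕD.n%n≡0 n))

    s₀-n : s n 0 (+ n) ≡ + suc n
    s₀-n = trans (s-up 0 (+ n) (sym 0%n≡n%n)) (cong +_ (ℕP.+-comm n 1))

    inner-%≢0%n : ∀ {a} → 1 ≤ a → a < n → a ℕ.% n ≢ 0 ℕ.% n
    inner-%≢0%n 1≤a a<n a≡0 =
      ℕP.<⇒≢ a<n (window-%-injective 1≤a (ℕP.<⇒≤ a<n) (ℕP.<⇒≤ 2≤n) ℕP.≤-refl (trans a≡0 0%n≡n%n))

    s₀-1 : s n 0 (+ 1) ≡ + 0
    s₀-1 = s-down 0 (+ 1) (inner-%≢0%n ℕP.≤-refl 2≤n) refl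

    s₀-inner : ∀ j → 1 < j → j < n → s n 0 (+ j) ≡ + j
    s₀-inner j 1<j j<n = s-fix 0 (+ j)
      (inner-%≢0%n 1≤j j<n)
      (ℕP.>⇒≢ 1<j ∘ window-%-injective 1≤j (ℕP.<⇒≤ j<n) ℕP.≤-refl (ℕP.<⇒≤ 2≤n))
      where
      1≤j : 1 ≤ j
      1≤j = ℕP.<⇒≤ 1<j

    ∘s-injective : ∀ {v : ℤ → ℤ} i → i < n → Injective _≡_ _≡_ v → Injective _≡_ _≡_ (v ∘ s n i)
    ∘s-injective i i<n injective {x} {y} eq =
      trans (sym (s-involutive i i<n x)) (trans (cong (s n i) (injective eq)) (s-involutive i i<n y))

    module _ {v : ℤ → ℤ} (periodic : Periodic v) (injective : Injective _≡_ _≡_ v) where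

      private
        v0≡vn-n : v (+ 0) ≡ v (+ n) - + n
        v0≡vn-n = periodic-0 {v} periodic

        separated : ∀ a b → 1 ≤ a → a ≤ n → 1 ≤ b → b ≤ n → a ≢ b → (v (+ b) - v (+ a)) %ℕ n ≢ 0
        separated _ _ = window-differences-%ℕ≢0 periodic injective

        cancel : ∀ a b → a + (b + + 1 - b) ≡ a + + 1
        cancel = solve-∀

      inversions-∘s-inner : ∀ i → 1 ≤ i → suc i ≤ n →
        inversions (v ∘ s n i) ≡ inversions v + (inversionsBetween v (suc i) i - inversionsBetween v i (suc i))
      inversions-∘s-inner i 1≤i 1+i≤n = pairSum-adjSwap n i _ _ 1≤i 1+i≤n λ a b 1≤a a<b b≤n →
        cong₂ (λ x y → classInversions (v x - v y))
          (s-window i b 1≤i 1+i≤n (ℕP.≤-trans 1≤a (ℕP.<⇒≤ a<b)) b≤n)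
          (s-window i a 1≤i 1+i≤n 1≤a (ℕP.≤-trans (ℕP.<⇒≤ a<b) b≤n))

      inversions-∘s₀ : inversions (v ∘ s n 0) ≡
        inversions v + (classInversions (+ n + + n - (v (+ n) - v (+ 1))) - inversionsBetween v 1 n)
      inversions-∘s₀ = trans (pairSum-swapEnds n _ _ 2≤n first-row last-column interior)
                             (cong (λ z → inversions v + (z - inversionsBetween v 1 n)) corner)
        where
        corner : inversionsBetween (v ∘ s n 0) 1 n ≡ classInversions (+ n + + n - (v (+ n) - v (+ 1)))
        corner = cong classInversions (begin
          v (s n 0 (+ n)) - v (s n 0 (+ 1))  ≡⟨ cong₂ (λ x y → v x - v y) s₀-n s₀-1 ⟩
          v (+ 1 + + n) - v (+ 0)            ≡⟨ cong₂ _-_ (periodic (+ 1)) v0≡vn-n ⟩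
          v (+ 1) + + n - (v (+ n) - + n)    ≡⟨ rearrange (v (+ 1)) (v (+ n)) (+ n) ⟩
          + n + + n - (v (+ n) - v (+ 1))    ∎)
          where
          open ≡-Reasoning
          rearrange : ∀ a b c → a + c - (b - c) ≡ c + c - (b - a)
          rearrange = solve-∀
        first-row : ∀ j → 1 < j → j < n → inversionsBetween (v ∘ s n 0) 1 j ≡ inversionsBetween v j n
        first-row j 1<j j<n = begin
          classInversions (v (s n 0 (+ j)) - v (s n 0 (+ 1)))
            ≡⟨ cong₂ (λ x y → classInversions (v x - v y)) (s₀-inner j 1<j j<n) s₀-1 ⟩
          classInversions (v (+ j) - v (+ 0))
            ≡⟨ cong (λ z → classInversions (v (+ j) - z)) v0≡vn-n ⟩
          classInversions (v (+ j) - (v (+ n) - + n))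
            ≡⟨ cong classInversions (rearrange (v (+ j)) (v (+ n)) (+ n)) ⟩
          classInversions (+ n - (v (+ n) - v (+ j)))
            ≡⟨ classInversions-shift (v (+ n) - v (+ j))
                 (separated j n (ℕP.<⇒≤ 1<j) (ℕP.<⇒≤ j<n) (ℕP.<⇒≤ 2≤n) ℕP.≤-refl (ℕP.<⇒≢ j<n)) ⟩
          classInversions (v (+ n) - v (+ j)) ∎
          where
          open ≡-Reasoning
          rearrange : ∀ a b c → a - (b - c) ≡ c - (b - a)
          rearrange = solve-∀
        last-column : ∀ j → 1 < j → j < n → inversionsBetween (v ∘ s n 0) j n ≡ inversionsBetween v 1 j
        last-column j 1<j j<n = begin
          classInversions (v (s n 0 (+ n)) - v (s n 0 (+ j)))
            ≡⟨ cong₂ (λ x y → classInversions (v x - v y)) s₀-n (s₀-inner j 1<j j<n) ⟩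
          classInversions (v (+ 1 + + n) - v (+ j))
            ≡⟨ cong classInversions (trans (cong (_- v (+ j)) (periodic (+ 1))) (rearrange (v (+ j)) (v (+ 1)) (+ n))) ⟩
          classInversions (+ n - (v (+ j) - v (+ 1)))
            ≡⟨ classInversions-shift (v (+ j) - v (+ 1))
                 (separated 1 j ℕP.≤-refl (ℕP.<⇒≤ 2≤n) (ℕP.<⇒≤ 1<j) (ℕP.<⇒≤ j<n) (ℕP.<⇒≢ 1<j)) ⟩
          classInversions (v (+ j) - v (+ 1)) ∎
          where
          open ≡-Reasoning
          rearrange : ∀ a b c → b + c - a ≡ c - (a - b)
          rearrange = solve-∀
        interior : ∀ a b → 1 < a → a < b → b < n → inversionsBetween (v ∘ s n 0) a b ≡ inversionsBetween v a b
        interior a b 1<a a<b b<n = cong₂ (λ x y → classInversions (v x - v y))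
          (s₀-inner b (ℕP.<-trans 1<a a<b) b<n) (s₀-inner a 1<a (ℕP.<-trans a<b b<n))

      inversions-∘s-ascent : ∀ i → i < n → v (+ i) ℤ.< v (+ suc i) → inversions (v ∘ s n i) ≡ inversions v + + 1
      inversions-∘s-ascent zero _ v0<v1 = begin
        inversions (v ∘ s n 0)
          ≡⟨ inversions-∘s₀ ⟩
        inversions v + (classInversions (+ n + + n - D) - classInversions D)
          ≡⟨ cong (λ z → inversions v + (z - classInversions D)) (classInversions-reflect₂ D D%n≢0 D<n) ⟩
        inversions v + (classInversions D + + 1 - classInversions D)
          ≡⟨ cancel (inversions v) (classInversions D) ⟩
        inversions v + + 1 ∎
        where
        open ≡-Reasoning
        D = v (+ n) - v (+ 1)
        D%n≢0 : D %ℕ n ≢ 0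
        D%n≢0 = separated 1 n (s≤s z≤n) (ℕP.<⇒≤ 2≤n) (ℕP.<⇒≤ 2≤n) ℕP.≤-refl (ℕP.<⇒≢ 2≤n)
        D<n : D ℤ.< + n
        D<n = <-shift (+ n - v (+ 1)) (subst (ℤ._< v (+ 1)) v0≡vn-n v0<v1)
                (telescope (v (+ n)) (v (+ 1)) (+ n)) (i+[j-i]≡j (v (+ 1)) (+ n))
          where
          telescope : ∀ a b c → a - c + (c - b) ≡ a - b
          telescope = solve-∀
          i+[j-i]≡j : ∀ i j → i + (j - i) ≡ j
          i+[j-i]≡j = solve-∀
      inversions-∘s-ascent (suc i) 1+i<n vi<v1+i = begin
        inversions (v ∘ s n (suc i))
          ≡⟨ inversions-∘s-inner (suc i) (s≤s z≤n) 1+i<n ⟩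
        inversions v + (classInversions (v (+ suc i) - v (+ suc (suc i))) - classInversions D)
          ≡⟨ cong (λ z → inversions v + (classInversions z - classInversions D)) (negate (v (+ suc i)) _) ⟩
        inversions v + (classInversions (- D) - classInversions D)
          ≡⟨ cong (λ z → inversions v + (z - classInversions D)) (classInversions-neg D D%n≢0 0<D) ⟩
        inversions v + (classInversions D + + 1 - classInversions D)
          ≡⟨ cancel (inversions v) (classInversions D) ⟩
        inversions v + + 1 ∎
        where
        open ≡-Reasoning
        D = v (+ suc (suc i)) - v (+ suc i)
        D%n≢0 : D %ℕ n ≢ 0
        D%n≢0 = separated (suc i) (suc (suc i)) (s≤s z≤n) (ℕP.<⇒≤ 1+i<n) (s≤s z≤n) 1+i<n (ℕP.<⇒≢ ℕP.≤-refl)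
        0<D : + 0 ℤ.< D
        0<D = <-shift (- v (+ suc i)) vi<v1+i (ℤP.+-inverseʳ (v (+ suc i))) refl
        negate : ∀ a b → a - b ≡ - (b - a)
        negate = solve-∀

    -- A descent of v at i is an ascent of v ∘ sᵢ, and (v ∘ sᵢ) ∘ sᵢ = v.
    inversions-∘s-descent : ∀ {v} → Periodic v → Injective _≡_ _≡_ v →
      ∀ i → i < n → v (+ suc i) ℤ.< v (+ i) → inversions (v ∘ s n i) + + 1 ≡ inversions v
    inversions-∘s-descent {v} periodic injective i i<n descent = begin
      inversions (v ∘ s n i) + + 1
        ≡⟨ sym (inversions-∘s-ascent (∘s-periodic {v} i periodic) (∘s-injective i i<n injective) i i<n ascent) ⟩
      inversions (v ∘ s n i ∘ s n i)
        ≡⟨ inversions-cong (cong v ∘ s-involutive i i<n) ⟩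
      inversions v ∎
      where
      open ≡-Reasoning
      ascent : v (s n i (+ i)) ℤ.< v (s n i (+ suc i))
      ascent = subst₂ (λ x y → v x ℤ.< v y) (sym (s-at-i i)) (sym (s-at-1+i i<n)) descent

    evalWord-reverse : ∀ ws x → evalWord n (reverse ws) (evalWord n ws x) ≡ x
    evalWord-reverse []       x = refl
    evalWord-reverse (a ∷ ws) x = begin
      evalWord n (reverse (a ∷ ws)) (sₐ y)   ≡⟨ cong (λ as → evalWord n as (sₐ y)) (LP.unfold-reverse a ws) ⟩
      evalWord n (reverse ws ∷ʳ a) (sₐ y)    ≡⟨ evalWord-++ (reverse ws) (a ∷ []) _ ⟩
      evalWord n (reverse ws) (sₐ (sₐ y))    ≡⟨ cong (evalWord n (reverse ws)) (s-involutive (toℕ a) (FP.toℕ<n a) y) ⟩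
      evalWord n (reverse ws) y              ≡⟨ evalWord-reverse ws x ⟩
      x                                      ∎
      where
      open ≡-Reasoning
      sₐ = s n (toℕ a)
      y = evalWord n ws x

    represents-inverse : ∀ ws {f g : ℤ → ℤ} → Represents n ws f → (∀ x → f (g x) ≡ x) →
      Represents n (reverse ws) g
    represents-inverse ws {f} {g} ws≗f f∘g≗id x = begin
      evalWord n (reverse ws) x                      ≡⟨ cong (evalWord n (reverse ws)) (sym (trans (ws≗f _) (f∘g≗id x))) ⟩
      evalWord n (reverse ws) (evalWord n ws (g x))  ≡⟨ evalWord-reverse ws (g x) ⟩
      g x                                            ∎
      where open ≡-Reasoning

    windowSum-∘s : ∀ {v : ℤ → ℤ} → Periodic v → ∀ i → i < n →
      ΣZ n (λ j → v (s n i (+ j))) ≡ ΣZ n (λ j → v (+ j))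
    windowSum-∘s {v} periodic zero _ = begin
      ΣZ n (λ j → v (s n 0 (+ j)))
        ≡⟨ ΣZ-update₂ n 1 n ℕP.≤-refl 1≤n 1≤n ℕP.≤-refl (ℕP.<⇒≢ 2≤n) fixed ⟩
      S + (v (s n 0 (+ 1)) - v (+ 1)) + (v (s n 0 (+ n)) - v (+ n))
        ≡⟨ cong₂ (λ x y → S + (v x - v (+ 1)) + (v y - v (+ n))) s₀-1 s₀-n ⟩
      S + (v (+ 0) - v (+ 1)) + (v (+ suc n) - v (+ n))
        ≡⟨ cong₂ (λ x y → S + (x - v (+ 1)) + (y - v (+ n))) (periodic-0 {v} periodic) (periodic (+ 1)) ⟩
      S + (v (+ n) - + n - v (+ 1)) + (v (+ 1) + + n - v (+ n))
        ≡⟨ cancel S (v (+ 1)) (v (+ n)) (+ n) ⟩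
      S ∎
      where
      open ≡-Reasoning
      S = ΣZ n (λ j → v (+ j))
      1≤n : 1 ≤ n
      1≤n = ℕP.<⇒≤ 2≤n
      fixed : ∀ a → 1 ≤ a → a ≤ n → a ≢ 1 → a ≢ n → v (s n 0 (+ a)) ≡ v (+ a)
      fixed a 1≤a a≤n a≢1 a≢n = cong v (s₀-inner a (ℕP.≤∧≢⇒< 1≤a (a≢1 ∘ sym)) (ℕP.≤∧≢⇒< a≤n a≢n))
      cancel : ∀ S a b c → S + (b - c - a) + (a + c - b) ≡ S
      cancel = solve-∀
    windowSum-∘s {v} periodic (suc i) 1+i<n = trans
      (ΣZ-cong n (λ j 1≤j j≤n → cong v (s-window (suc i) j (s≤s z≤n) 1+i<n 1≤j j≤n)))
      (ΣZ-adjSwap n (suc i) (λ j → v (+ j)) (s≤s z≤n) 1+i<n)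

    IsAffPerm-∘s : ∀ {v : ℤ → ℤ} → IsAffPerm n v → ∀ i → i < n → IsAffPerm n (v ∘ s n i)
    IsAffPerm-∘s {v} v-aff i i<n = record
      { injective  = ∘s-injective i i<n injective
      ; surjective = λ y → let (x , vx≡y) = surjective y in
                       s n i x , λ {z} z≡six → vx≡y (trans (cong (s n i) z≡six) (s-involutive i i<n x))
      ; periodic   = ∘s-periodic {v} i periodic
      ; windowSum  = trans (windowSum-∘s {v} periodic i i<n) windowSum
      }
      where open IsAffPerm v-aff

    IsAffPerm-∘evalWord : ∀ {v : ℤ → ℤ} → IsAffPerm n v → ∀ ws → IsAffPerm n (v ∘ evalWord n ws)
    IsAffPerm-∘evalWord v-aff []       = v-aff
    IsAffPerm-∘evalWord v-aff (a ∷ ws) = IsAffPerm-∘evalWord (IsAffPerm-∘s v-aff (toℕ a) (FP.toℕ<n a)) ws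

    inversions-∘s≤ : ∀ {v : ℤ → ℤ} → IsAffPerm n v → ∀ i → i < n →
      inversions (v ∘ s n i) ℤ.≤ inversions v + + 1
    inversions-∘s≤ {v} v-aff i i<n with ℤP.<-cmp (v (+ i)) (v (+ suc i))
    ... | tri< ascent _ _ = ℤP.≤-reflexive (inversions-∘s-ascent periodic injective i i<n ascent)
      where open IsAffPerm v-aff
    ... | tri≈ _ vi≡v1+i _ = ⊥-elim (ℕP.1+n≢n (sym (ℤP.+-injective (injective vi≡v1+i))))
      where open IsAffPerm v-aff
    ... | tri> _ _ descent = begin
      inversions (v ∘ s n i)              ≤⟨ ℤP.i≤i+j (inversions (v ∘ s n i)) (+ 2) ⟩
      inversions (v ∘ s n i) + + 2        ≡⟨ sym (ℤP.+-assoc (inversions (v ∘ s n i)) (+ 1) (+ 1)) ⟩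
      inversions (v ∘ s n i) + + 1 + + 1  ≡⟨ cong (_+ + 1) (inversions-∘s-descent periodic injective i i<n descent) ⟩
      inversions v + + 1                  ∎
      where
      open IsAffPerm v-aff
      open ℤP.≤-Reasoning

    inversions-∘evalWord≤ : ∀ {v : ℤ → ℤ} → IsAffPerm n v → ∀ ws →
      inversions (v ∘ evalWord n ws) ℤ.≤ inversions v + + length ws
    inversions-∘evalWord≤ v-aff []           = ℤP.≤-reflexive (sym (ℤP.+-identityʳ _))
    inversions-∘evalWord≤ {v} v-aff (a ∷ ws) = begin
      inversions (v ∘ sₐ ∘ evalWord n ws)  ≤⟨ inversions-∘evalWord≤ (IsAffPerm-∘s v-aff (toℕ a) a<n) ws ⟩
      inversions (v ∘ sₐ) + + length ws    ≤⟨ ℤP.+-monoˡ-≤ (+ length ws) (inversions-∘s≤ v-aff (toℕ a) a<n) ⟩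
      inversions v + + 1 + + length ws     ≡⟨ ℤP.+-assoc (inversions v) (+ 1) (+ length ws) ⟩
      inversions v + + length (a ∷ ws)     ∎
      where
      open ℤP.≤-Reasoning
      sₐ = s n (toℕ a)
      a<n : toℕ a < n
      a<n = FP.toℕ<n a

    inversions≤length : ∀ ws {v : ℤ → ℤ} → Represents n ws v → inversions v ℤ.≤ + length ws
    inversions≤length ws {v} ws≗v = begin
      inversions v                       ≡⟨ inversions-cong (sym ∘ ws≗v) ⟩
      inversions (evalWord n ws)         ≤⟨ inversions-∘evalWord≤ IsAffPerm-id ws ⟩
      inversions (λ x → x) + + length ws ≡⟨ cong (_+ + length ws) inversions-id ⟩
      + length ws                        ∎
      where open ℤP.≤-Reasoning

    ascent? : ∀ (v : ℤ → ℤ) (i : Fin n) → Dec (v (+ toℕ i) ℤ.< v (+ suc (toℕ i)))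
    ascent? v i = v (+ toℕ i) ℤP.<? v (+ suc (toℕ i))

    descent? : ∀ (v : ℤ → ℤ) →
      (∀ i → i < n → v (+ i) ℤ.< v (+ suc i)) ⊎ Σ (Fin n) λ i → ¬ (v (+ toℕ i) ℤ.< v (+ suc (toℕ i)))
    descent? v with FP.all? (ascent? v)
    ... | yes ascending =
      inj₁ λ i i<n → subst (λ k → v (+ k) ℤ.< v (+ suc k)) (FP.toℕ-fromℕ< i<n) (ascending (fromℕ< i<n))
    ... | no ¬ascending = inj₂ (FP.¬∀⟶∃¬ n _ (ascent? v) ¬ascending)

    word-of-inversions : ∀ m {v : ℤ → ℤ} → IsAffPerm n v → inversions v ≡ + m → HasWordOfLength v m
    word-of-inversions m {v} v-aff inv≡m with descent? v
    ... | inj₁ ascending = [] , ℤP.+-injective (trans (sym inv≡0) inv≡m) , sym ∘ ascending⇒id v-aff ascending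
      where
      inv≡0 : inversions v ≡ + 0
      inv≡0 = trans (inversions-cong (ascending⇒id v-aff ascending)) inversions-id
    ... | inj₂ (i , ¬ascent) = shorten m inv≡m
      where
      open IsAffPerm v-aff
      i<n : toℕ i < n
      i<n = FP.toℕ<n i
      descent : v (+ suc (toℕ i)) ℤ.< v (+ toℕ i)
      descent = ℤP.≤∧≢⇒< (ℤP.≮⇒≥ ¬ascent) (λ eq → ℕP.1+n≢n (ℤP.+-injective (injective eq)))
      inv-drop : inversions (v ∘ s n (toℕ i)) + + 1 ≡ inversions v
      inv-drop = inversions-∘s-descent periodic injective (toℕ i) i<n descent
      shorten : ∀ m → inversions v ≡ + m → HasWordOfLength v m
      shorten zero    inv≡0   = ⊥-elim (0≤i⇒i+1≢0 (inversions-nonNeg (v ∘ s n (toℕ i))) (trans inv-drop inv≡0))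
      shorten (suc m) inv≡1+m with word-of-inversions m (IsAffPerm-∘s v-aff (toℕ i) i<n)
                                     (∙-cancelʳ (+ 1) _ (+ m) (trans inv-drop (trans inv≡1+m (cong +_ (ℕP.+-comm 1 m)))))
      ... | ws , length≡m , ws≗v∘s =
        ws ∷ʳ i ,
        trans (LP.length-++ ws) (trans (cong (ℕ._+ 1) length≡m) (ℕP.+-comm m 1)) ,
        λ x → trans (evalWord-++ ws (i ∷ []) x) (trans (ws≗v∘s _) (cong v (s-involutive (toℕ i) i<n x)))

    minimal-word : ∀ {v : ℤ → ℤ} → IsAffPerm n v →
      Σ (List (Fin n)) λ ws → + length ws ≡ inversions v × Represents n ws v
    minimal-word {v} v-aff =
      let ws , length≡ , ws≗v = word-of-inversions ∣ inversions v ∣ v-aff (sym ∣inv∣≡inv)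
      in  ws , trans (cong +_ length≡) ∣inv∣≡inv , ws≗v
      where
      ∣inv∣≡inv : + ∣ inversions v ∣ ≡ inversions v
      ∣inv∣≡inv = ℤP.0≤i⇒+∣i∣≡i (inversions-nonNeg v)

    IsLength⇒≡inversions : ∀ {v : ℤ → ℤ} {k} → IsAffPerm n v → IsLength n v k → + k ≡ inversions v
    IsLength⇒≡inversions {v} {k} v-aff ((ws , length≡k , ws≗v) , minimal) with minimal-word v-aff
    ... | ws′ , length′≡inv , ws′≗v = ℤP.≤-antisym
      (subst (+ k ℤ.≤_) length′≡inv (ℤ.+≤+ (minimal ws′ ws′≗v)))
      (subst (λ m → inversions v ℤ.≤ + m) length≡k (inversions≤length ws ws≗v))

    IsLength-inverse : ∀ {f g : ℤ → ℤ} {k} → (∀ x → f (g x) ≡ x) → (∀ x → g (f x) ≡ x) →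
      IsLength n f k → IsLength n g k
    IsLength-inverse {k = k} f∘g≗id g∘f≗id ((ws , length≡k , ws≗f) , minimal) =
      (reverse ws , trans (LP.length-reverse ws) length≡k , represents-inverse ws ws≗f f∘g≗id) ,
      λ ws′ ws′≗g →
        subst (k ≤_) (LP.length-reverse ws′) (minimal (reverse ws′) (represents-inverse ws′ ws′≗g g∘f≗id))

    ascent-of-length : ∀ {v : ℤ → ℤ} {k} → IsAffPerm n v → IsLength n v k →
      ∀ i → i < n → IsLength n (v ∘ s n i) (suc k) → v (+ i) ℤ.< v (+ suc i)
    ascent-of-length {v} {k} v-aff v-length i i<n longer with ℤP.<-cmp (v (+ i)) (v (+ suc i))
    ... | tri< ascent _ _ = ascent
    ... | tri≈ _ vi≡v1+i _ = ⊥-elim (ℕP.1+n≢n (sym (ℤP.+-injective (IsAffPerm.injective v-aff vi≡v1+i))))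
    ... | tri> _ _ descent =
      ⊥-elim (ℕP.<⇒≢ (ℕP.≤-trans (ℕP.n<1+n k) (ℕP.m≤m+n (suc k) 1)) (sym (ℤP.+-injective 2+k≡k)))
      where
      open IsAffPerm v-aff
      2+k≡k : + suc k + + 1 ≡ + k
      2+k≡k = begin
        + suc k + + 1                   ≡⟨ cong (_+ + 1) (IsLength⇒≡inversions (IsAffPerm-∘s v-aff i i<n) longer) ⟩
        inversions (v ∘ s n i) + + 1    ≡⟨ inversions-∘s-descent periodic injective i i<n descent ⟩
        inversions v                    ≡⟨ sym (IsLength⇒≡inversions v-aff v-length) ⟩
        + k                             ∎
        where open ≡-Reasoning

    ascent-of-inverse : ∀ {w u : ℤ → ℤ} {k} → IsAffPerm n u → (∀ x → u (w x) ≡ x) → (∀ x → w (u x) ≡ x) →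
      IsLength n w k → ∀ i → i < n → IsLength n (s n i ∘ w) (suc k) → u (+ i) ℤ.< u (+ suc i)
    ascent-of-inverse {w} {u} u-aff u∘w≗id w∘u≗id w-length i i<n longer =
      ascent-of-length u-aff (IsLength-inverse w∘u≗id u∘w≗id w-length) i i<n
        (IsLength-inverse (λ x → trans (cong (s n i) (w∘u≗id _)) (s-involutive i i<n x))
                          (λ x → trans (cong u (s-involutive i i<n (w x))) (u∘w≗id x))
                          longer)

  module _ {w u : ℤ → ℤ} (periodic : Periodic w) (injective : Injective _≡_ _≡_ w)
           (u∘w≗id : ∀ x → u (w x) ≡ x)
           (w-increasing : ∀ i j → 1 ≤ i → i < j → j ≤ n → w (+ i) ℤ.< w (+ j))
           (u-increasing : ∀ i j → 1 ≤ i → i < j → j ≤ n → u (+ i) ℤ.< u (+ j)) where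

    private
      a : ℕ → ℤ
      a = λᵢ n w

      ρ : ℕ → ℕ
      ρ x = (w (+ x) - + 1) %ℕ n

      w≡ : ∀ x → w (+ x) ≡ + ρ x + a x * + n + + 1
      w≡ x = trans (sym (i-1+1≡i (w (+ x)))) (cong (_+ + 1) (a≡a%ℕn+[a/ℕn]*n (w (+ x) - + 1) n))

      u-at-residue : ∀ x → u (+ suc (ρ x)) ≡ + x + (- a x) * + n
      u-at-residue x = trans (cong u (sym w-shifted)) (u∘w≗id _)
        where
        w-shifted : w (+ x + (- a x) * + n) ≡ + suc (ρ x)
        w-shifted = trans (periodic-* {w} periodic (+ x) (- a x))
          (trans (cong (_+ (- a x) * + n) (w≡ x)) (cancel (+ ρ x) (a x) (+ n)))
          where
          cancel : ∀ r q n → r + q * n + + 1 + (- q) * n ≡ + 1 + r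
          cancel = solve-∀

      difference : ∀ i j → w (+ j) - w (+ i) ≡ + ρ j - + ρ i + (a j - a i) * + n
      difference i j = trans (cong₂ _-_ (w≡ j) (w≡ i)) (rearrange (+ ρ i) (+ ρ j) (a i) (a j) (+ n))
        where
        rearrange : ∀ r s p q n → (s + q * n + + 1) - (r + p * n + + 1) ≡ s - r + (q - p) * n
        rearrange = solve-∀

      +m-+n≡+[m∸n] : ∀ {m k} → k ≤ m → + m - + k ≡ + (m ∸ k)
      +m-+n≡+[m∸n] {m} {k} k≤m = trans (ℤP.m-n≡m⊖n m k) (ℤP.⊖-≥ k≤m)

      module _ {i j} (1≤i : 1 ≤ i) (i<j : i < j) (j≤n : j ≤ n) where

        0<D : + 0 ℤ.< w (+ j) - w (+ i)
        0<D = <-shift (- w (+ i)) (w-increasing i j 1≤i i<j j≤n) (ℤP.+-inverseʳ (w (+ i))) refl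

        0≤D/n : + 0 ℤ.≤ (w (+ j) - w (+ i)) /ℕ n
        0≤D/n = 0≤⇒0≤/ℕ n (ℤP.<⇒≤ 0<D)

        D/n-below : ρ i < ρ j → (w (+ j) - w (+ i)) /ℕ n ≡ a j - a i
        D/n-below ρi<ρj =
          /ℕ-of-rep n (a j - a i) (ℕP.≤-<-trans (ℕP.m∸n≤m (ρ j) (ρ i)) (n%ℕd<d (w (+ j) - + 1) n))
            (trans (difference i j) (cong (λ r → r + (a j - a i) * + n) (+m-+n≡+[m∸n] (ℕP.<⇒≤ ρi<ρj))))

        D/n-above : ρ j < ρ i → (w (+ j) - w (+ i)) /ℕ n ≡ a j - a i - + 1
        D/n-above ρj<ρi = /ℕ-of-rep n (a j - a i - + 1) (ℕP.∸-monoʳ-< 0<e e≤n) (begin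
          w (+ j) - w (+ i)                         ≡⟨ difference i j ⟩
          + ρ j - + ρ i + t * + n                   ≡⟨ cong (λ r → r + t * + n) ρj-ρi≡-e ⟩
          - + e + t * + n                           ≡⟨ cong (λ m → - + e + t * m) (sym n≡X+e) ⟩
          - + e + t * (+ (n ∸ e) + + e)             ≡⟨ rearrange (+ (n ∸ e)) (+ e) t ⟩
          + (n ∸ e) + (t - + 1) * (+ (n ∸ e) + + e) ≡⟨ cong (λ m → + (n ∸ e) + (t - + 1) * m) n≡X+e ⟩
          + (n ∸ e) + (t - + 1) * + n               ∎)
          where
          open ≡-Reasoning
          t = a j - a i
          e = ρ i ∸ ρ j
          0<e : 0 < e
          0<e = ℕP.m<n⇒0<n∸m ρj<ρi
          e≤n : e ≤ n
          e≤n = ℕP.≤-trans (ℕP.m∸n≤m (ρ i) (ρ j)) (ℕP.<⇒≤ (n%ℕd<d (w (+ i) - + 1) n))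
          n≡X+e : + (n ∸ e) + + e ≡ + n
          n≡X+e = cong +_ (ℕP.m∸n+n≡m e≤n)
          ρj-ρi≡-e : + ρ j - + ρ i ≡ - + e
          ρj-ρi≡-e = trans (negate (+ ρ j) (+ ρ i)) (cong -_ (+m-+n≡+[m∸n] (ℕP.<⇒≤ ρj<ρi)))
            where
            negate : ∀ a b → a - b ≡ - (b - a)
            negate = solve-∀
          rearrange : ∀ X e t → - e + t * (X + e) ≡ X + (t - + 1) * (X + e)
          rearrange = solve-∀

        same-block : ρ i < ρ j → a j - a i ≡ + 0
        same-block ρi<ρj = ℤP.≤-antisym (i<suc[j]⇒i≤j t<1) (subst (+ 0 ℤ.≤_) (D/n-below ρi<ρj) 0≤D/n)
          where
          t = a j - a i
          u-gap : + i + (- a i) * + n ℤ.< + j + (- a j) * + n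
          u-gap = subst₂ ℤ._<_ (u-at-residue i) (u-at-residue j)
            (u-increasing (suc (ρ i)) (suc (ρ j)) (s≤s z≤n) (s≤s ρi<ρj) (n%ℕd<d (w (+ j) - + 1) n))
          t*n<j-i : t * + n ℤ.< + j - + i
          t*n<j-i = <-shift (a j * + n - + i) u-gap
            (rearrange₁ (+ i) (a i) (a j) (+ n)) (rearrange₂ (+ i) (+ j) (a j) (+ n))
            where
            rearrange₁ : ∀ i p q n → i + (- p) * n + (q * n - i) ≡ (q - p) * n
            rearrange₁ = solve-∀
            rearrange₂ : ∀ i j q n → j + (- q) * n + (q * n - i) ≡ j - i
            rearrange₂ = solve-∀
          j-i<n : + j - + i ℤ.< + 1 * + n
          j-i<n = subst₂ ℤ._<_ (sym (+m-+n≡+[m∸n] (ℕP.<⇒≤ i<j))) (sym (ℤP.*-identityˡ (+ n)))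
                    (ℤ.+<+ (ℕP.<-≤-trans (ℕP.∸-monoʳ-< 1≤i (ℕP.<⇒≤ i<j)) j≤n))
          t<1 : t ℤ.< + 1
          t<1 = ℤP.*-cancelʳ-<-nonNeg (+ n) (ℤP.<-trans t*n<j-i j-i<n)

      distinct-residues : ∀ {i j} → 1 ≤ i → i < j → j ≤ n → ρ i ≢ ρ j
      distinct-residues {i} {j} 1≤i i<j j≤n ρi≡ρj =
        window-differences-%ℕ≢0 periodic injective 1≤i i≤n (ℕP.≤-trans 1≤i (ℕP.<⇒≤ i<j)) j≤n (ℕP.<⇒≢ i<j)
          (%ℕ-of-rep n (a j - a i) (ℕP.<-≤-trans 1≤i i≤n) (trans (difference i j) (cong (_+ (a j - a i) * + n) ρj-ρi≡0)))
        where
        i≤n : i ≤ n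
        i≤n = ℕP.<⇒≤ (ℕP.<-≤-trans i<j j≤n)
        ρj-ρi≡0 : + ρ j - + ρ i ≡ + 0
        ρj-ρi≡0 = trans (cong (λ r → + ρ j - + r) ρi≡ρj) (ℤP.+-inverseʳ (+ ρ j))

    shi-pair : ∀ i j → 1 ≤ i → i < j → j ≤ n →
      (inversionsBetween w i j ≡ (a j - a i - + 1) ⊔ + 0) × (inversionsBetween w i j ≡ a j - a i + 𝟙≡ (a i) (a j) - + 1)
    shi-pair i j 1≤i i<j j≤n with ℕP.<-cmp (ρ i) (ρ j)
    ... | tri≈ _ ρi≡ρj _ = ⊥-elim (distinct-residues 1≤i i<j j≤n ρi≡ρj)
    ... | tri< ρi<ρj _ _ =
      map (trans classInv≡0) (trans classInv≡0) (shi-term-equal (a i) (a j) (same-block 1≤i i<j j≤n ρi<ρj))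
      where
      classInv≡0 : classInversions (w (+ j) - w (+ i)) ≡ + 0
      classInv≡0 = cong (λ q → + ∣ q ∣) (trans (D/n-below 1≤i i<j j≤n ρi<ρj) (same-block 1≤i i<j j≤n ρi<ρj))
    ... | tri> _ _ ρj<ρi =
      map (trans classInv≡) (trans classInv≡) (shi-term-apart (a i) (a j) (subst (+ 0 ℤ.≤_) D/n≡ (0≤D/n 1≤i i<j j≤n)))
      where
      D/n≡ : (w (+ j) - w (+ i)) /ℕ n ≡ a j - a i - + 1
      D/n≡ = D/n-above 1≤i i<j j≤n ρj<ρi
      classInv≡ : classInversions (w (+ j) - w (+ i)) ≡ + ∣ a j - a i - + 1 ∣
      classInv≡ = cong (λ q → + ∣ q ∣) D/n≡

lemma2p15 : (n : ℕ) .{{_ : NonZero n}} → 2 ≤ n → (w : ℤ → ℤ) → IsAffPerm n w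
    → (∀ x → (τ n ∘ w) ((τ n ∘ w) x) ≡ x)
    → (k : ℕ) → IsLength n w k
    → (∀ i → 1 ≤ i → i < n → IsLength n (s n i ∘ w) (suc k) × IsLength n (w ∘ s n i) (suc k))
    → (+ k ≡ pairSum n (λ i j → (λᵢ n w j - λᵢ n w i - + 1) ⊔ + 0))
      × (+ k ≡ pairSum n (λ i j → λᵢ n w j - λᵢ n w i + 𝟙≡ (λᵢ n w i) (λᵢ n w j)) - + (n C 2))
lemma2p15 n 2≤n w w-aff _ k w-length@((ws , _ , ws≗w) , _) longer =
  trans k≡inv (pairSum-cong n λ i j 1≤i i<j j≤n → proj₁ (shi i j 1≤i i<j j≤n)) ,
  trans k≡inv (trans (pairSum-cong n λ i j 1≤i i<j j≤n → proj₂ (shi i j 1≤i i<j j≤n)) (pairSum-sub-one n _))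
  where
  open IsAffPerm w-aff
  k≡inv : + k ≡ inversions n w
  k≡inv = IsLength⇒≡inversions n 2≤n w-aff w-length
  u : ℤ → ℤ
  u = evalWord n (reverse ws)
  u∘w≗id : ∀ x → u (w x) ≡ x
  u∘w≗id x = trans (cong u (sym (ws≗w x))) (evalWord-reverse n 2≤n ws x)
  w∘u≗id : ∀ x → w (u x) ≡ x
  w∘u≗id x = trans (sym (ws≗w (u x)))
    (subst (λ vs → evalWord n vs (u x) ≡ x) (LP.reverse-involutive ws) (evalWord-reverse n 2≤n (reverse ws) x))
  w-ascent : ∀ i → 1 ≤ i → i < n → w (+ i) ℤ.< w (+ suc i)
  w-ascent i 1≤i i<n = ascent-of-length n 2≤n w-aff w-length i i<n (proj₂ (longer i 1≤i i<n))
  u-ascent : ∀ i → 1 ≤ i → i < n → u (+ i) ℤ.< u (+ suc i)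
  u-ascent i 1≤i i<n = ascent-of-inverse n 2≤n (IsAffPerm-∘evalWord n 2≤n (IsAffPerm-id n) (reverse ws))
    u∘w≗id w∘u≗id w-length i i<n (proj₁ (longer i 1≤i i<n))
  shi : ∀ i j → 1 ≤ i → i < j → j ≤ n →
    (inversionsBetween n w i j ≡ (λᵢ n w j - λᵢ n w i - + 1) ⊔ + 0) ×
    (inversionsBetween n w i j ≡ λᵢ n w j - λᵢ n w i + 𝟙≡ (λᵢ n w i) (λᵢ n w j) - + 1)
  shi = shi-pair n {w} {u} periodic injective u∘w≗id (adjacent⇒increasing w w-ascent) (adjacent⇒increasing u u-ascent)
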